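{- For every Scott domain $D$ there are equivalences of types $$\mathrm{Sharp}(D) \simeq \mathrm{SpecPt}(\mathrm{Scott}(D)) \simeq \mathrm{SpecPt}(\mathrm{Patch}(\mathrm{Scott}(D))) \simeq \mathrm{Pt}(\mathrm{Patch}(\mathrm{Scott}(D))).$$
   Context: Setting: univalent type theory with universes, function and propositional extensionality, propositional truncations. Fix base universe $\mathcal{U}$; small means equivalent to a type in $\mathcal{U}$. A frame has carrier in $\mathcal{U}^+$, $\Omega_{\mathcal{U}}$-valued partial order, top, binary meets, joins of families indexed by types in $\mathcal{U}$, with distributivity; a locale $X$ has frame $\mathcal{O}(X)$. A dcpo $D$ has carrier in $\mathcal{U}^+$, $\Omega_{\mathcal{U}}$-valued order $\sqsubseteq$, and joins of small directed families; $c$ is finite if $c\sqsubseteq\bigsqcup x_i$ (small directed) implies $c\sqsubseteq x_i$ for some $i$; $D$ is algebraic if every $x$ is the join of the directed family of finite elements below it and the type of finite elements is small. A Scott domain is an algebraic dcpo with least element, bounded complete (small families with an upper bound have a least upper bound), in which existence of a common upper bound of two finite elements is decidable. $\mathrm{Scott}(D)$ is the locale of Scott open subsets (upward closed, inaccessible by small directed joins) ordered by inclusion. An open (or element of a frame) is compact if whenever it is below the join of a small directed family it is below some member. For a spectral locale $X$ (compact top, compact opens closed under binary meets, every open a join of a small directed family of compact opens, small type of compact opens), $\mathrm{Patch}(X)$ is the locale whose frame is the frame of Scott continuous nuclei on $X$ (inflationary, binary-meet-preserving, idempotent endomaps of $\mathcal{O}(X)$ preserving small directed joins), ordered pointwise,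 with meets pointwise and joins of small families $(k_i)_{i:I}$ given by $U\mapsto\bigvee_{s:\mathrm{List}(I)}k_{i_{n-1}}\circ\dots\circ k_{i_0}(U)$. A point of $X$ is a frame homomorphism $\mathcal{O}(X)\to\Omega_{\mathcal{U}}$; $\mathrm{Pt}(X)$ is the type of points; a point is spectral if it sends compact opens to compact elements of $\Omega_{\mathcal{U}}$; $\mathrm{SpecPt}(X)$ is the type of spectral points. $x\in D$ is sharp if $c\sqsubseteq x$ is decidable for all finite $c$; $\mathrm{Sharp}(D)$ is the type of sharp elements. (For a Scott domain $D$, $\mathrm{Scott}(D)$ is spectral, so its patch is defined.) -}

module Defs where

open import Level using (Level; _⊔_; Setω) renaming (suc to lsuc)
open import Data.Product using (Σ; _×_; _,_; proj₁; proj₂)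
open import Data.Unit.Polymorphic using (⊤; tt)
open import Data.List using (List; []; _∷_)
open import Relation.Nullary using (Dec)
open import Relation.Binary.PropositionalEquality using (_≡_; refl; cong₂)
open import Function using (_∘_; id)

isProp : ∀ {ℓ} → Set ℓ → Set ℓ
isProp A = (x y : A) → x ≡ y

isSet : ∀ {ℓ} → Set ℓ → Set ℓ
isSet A = (x y : A) → isProp (x ≡ y)

_∼_ : ∀ {a b} {A : Set a} {B : Set b} → (A → B) → (A → B) → Set (a ⊔ b)
f ∼ g = ∀ x → f x ≡ g x

isEquiv : ∀ {a b} {A : Set a} {B : Set b} → (A → B) → Set (a ⊔ b)
isEquiv {A = A} {B} f = (Σ (B → A) (λ g → (f ∘ g) ∼ id)) × (Σ (B → A) (λ h → (h ∘ f) ∼ id))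

_≃_ : ∀ {a b} → Set a → Set b → Set (a ⊔ b)
A ≃ B = Σ (A → B) isEquiv

infix 4 _≃_

FunExt : Setω
FunExt = ∀ {a b} {A : Set a} {B : A → Set b} {f g : (x : A) → B x}
         → (∀ x → f x ≡ g x) → f ≡ g

PropExt : Setω
PropExt = ∀ {ℓ} {P Q : Set ℓ} → isProp P → isProp Q → (P → Q) → (Q → P) → P ≡ Q

record PropTrunc : Setω where
  field
    ∥_∥ : ∀ {ℓ} → Set ℓ → Set ℓ
    ∥∥-isProp : ∀ {ℓ} {A : Set ℓ} → isProp ∥ A ∥
    ∣_∣ : ∀ {ℓ} {A : Set ℓ} → A → ∥ A ∥
    ∥∥-rec : ∀ {ℓ ℓ'} {A : Set ℓ} {P : Set ℓ'} → isProp P → (A → P) → ∥ A ∥ → P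

module Theory (pt : PropTrunc) (u : Level) where
  open PropTrunc pt public

  𝓤⁺ : Level
  𝓤⁺ = lsuc u

  isSmall : ∀ {ℓ} → Set ℓ → Set (lsuc u ⊔ ℓ)
  isSmall X = Σ (Set u) (λ B → B ≃ X)

  Ω : Set 𝓤⁺
  Ω = Σ (Set u) isProp

  _holds : Ω → Set u
  P holds = proj₁ P

  ⊤Ω : Ω
  ⊤Ω = ⊤ , λ _ _ → refl

  _∧Ω_ : Ω → Ω → Ω
  (P , p) ∧Ω (Q , q) = (P × Q) , λ { (a , b) (a' , b') → cong₂ _,_ (p a a') (q b b') }

  ⋁Ω : {I : Set u} → (I → Ω) → Ω
  ⋁Ω {I} U = ∥ Σ I (λ i → U i holds) ∥ , ∥∥-isProp

  Directed : ∀ {ℓx ℓr ℓi} {X : Set ℓx} (_≤_ : X → X → Set ℓr) {I : Set ℓi}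
             → (I → X) → Set (ℓr ⊔ ℓi)
  Directed _≤_ {I} α = ∥ I ∥ × ((i j : I) → ∥ Σ I (λ k → (α i ≤ α k) × (α j ≤ α k)) ∥)

  record DCPO : Set (lsuc 𝓤⁺) where
    field
      ⟨_⟩ : Set 𝓤⁺
      carrier-isSet : isSet ⟨_⟩
      _⊑_ : ⟨_⟩ → ⟨_⟩ → Set u
      ⊑-prop : ∀ x y → isProp (x ⊑ y)
      ⊑-refl : ∀ x → x ⊑ x
      ⊑-trans : ∀ x y z → x ⊑ y → y ⊑ z → x ⊑ z
      ⊑-antisym : ∀ x y → x ⊑ y → y ⊑ x → x ≡ y
      ⨆ : {I : Set u} (α : I → ⟨_⟩) → Directed _⊑_ α → ⟨_⟩
      ⨆-upper : {I : Set u} (α : I → ⟨_⟩) (δ : Directed _⊑_ α) → ∀ i → α i ⊑ ⨆ α δ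
      ⨆-least : {I : Set u} (α : I → ⟨_⟩) (δ : Directed _⊑_ α)
                → ∀ y → (∀ i → α i ⊑ y) → ⨆ α δ ⊑ y

  module _ (D : DCPO) where
    open DCPO D

    isLub : ∀ {ℓi} {I : Set ℓi} → (I → ⟨_⟩) → ⟨_⟩ → Set (𝓤⁺ ⊔ ℓi)
    isLub {I = I} α s = (∀ i → α i ⊑ s) × (∀ y → (∀ i → α i ⊑ y) → s ⊑ y)

    isFinite : ⟨_⟩ → Set 𝓤⁺
    isFinite c = {I : Set u} (α : I → ⟨_⟩) (δ : Directed _⊑_ α)
                 → c ⊑ ⨆ α δ → ∥ Σ I (λ i → c ⊑ α i) ∥

    K : Set 𝓤⁺
    K = Σ ⟨_⟩ isFinite

    K↓ : ⟨_⟩ → Set 𝓤⁺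
    K↓ x = Σ ⟨_⟩ (λ c → isFinite c × (c ⊑ x))

    K↓-incl : (x : ⟨_⟩) → K↓ x → ⟨_⟩
    K↓-incl x = proj₁

    isAlgebraic : Set 𝓤⁺
    isAlgebraic = ((x : ⟨_⟩) → Directed _⊑_ (K↓-incl x) × isLub (K↓-incl x) x)
                  × isSmall K

    hasLeast : Set 𝓤⁺
    hasLeast = Σ ⟨_⟩ (λ ⊥ → ∀ x → ⊥ ⊑ x)

    isBoundedComplete : Set 𝓤⁺
    isBoundedComplete = {I : Set u} (α : I → ⟨_⟩)
                        → ∥ Σ ⟨_⟩ (λ b → ∀ i → α i ⊑ b) ∥
                        → Σ ⟨_⟩ (λ s → isLub α s)

    hasDecidableUpperBounds : Set 𝓤⁺
    hasDecidableUpperBounds = (c d : ⟨_⟩) → isFinite c → isFinite d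
                              → Dec ∥ Σ ⟨_⟩ (λ b → (c ⊑ b) × (d ⊑ b)) ∥

    isSharp : ⟨_⟩ → Set 𝓤⁺
    isSharp x = (c : ⟨_⟩) → isFinite c → Dec (c ⊑ x)

    Sharp : Set 𝓤⁺
    Sharp = Σ ⟨_⟩ isSharp

    isScottOpen : (⟨_⟩ → Ω) → Set 𝓤⁺
    isScottOpen U = ((x y : ⟨_⟩) → U x holds → x ⊑ y → U y holds)
                  × ({I : Set u} (α : I → ⟨_⟩) (δ : Directed _⊑_ α)
                     → U (⨆ α δ) holds → ∥ Σ I (λ i → U (α i) holds) ∥)

  record ScottDomain : Set (lsuc 𝓤⁺) where
    field
      dcpo : DCPO
      algebraic : isAlgebraic dcpo
      least : hasLeast dcpo
      bounded-complete : isBoundedComplete dcpo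
      decidable-upper-bounds : hasDecidableUpperBounds dcpo

  -- Frames (= locales), presented by their order and by the graphs of
  -- top, binary meet and small join: IsTop t, IsMeet a b m ("m = a ∧ b"),
  -- IsJoin U m ("m = ⋁ U").
  record Frame (ℓ : Level) : Set (lsuc 𝓤⁺ ⊔ lsuc ℓ) where
    field
      ⟪_⟫ : Set 𝓤⁺
      _≤_ : ⟪_⟫ → ⟪_⟫ → Set ℓ
      IsTop : ⟪_⟫ → Set 𝓤⁺
      IsMeet : ⟪_⟫ → ⟪_⟫ → ⟪_⟫ → Set 𝓤⁺
      IsJoin : {I : Set u} → (I → ⟪_⟫) → ⟪_⟫ → Set 𝓤⁺

  open Frame public

  ΩFrame : Frame u
  ΩFrame = record
    { ⟪_⟫ = Ω
    ; _≤_ = λ P Q → P holds → Q holds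
    ; IsTop = λ t → t ≡ ⊤Ω
    ; IsMeet = λ p q m → m ≡ (p ∧Ω q)
    ; IsJoin = λ U m → m ≡ ⋁Ω U
    }

  isCompact : ∀ {ℓ} (X : Frame ℓ) → ⟪ X ⟫ → Set (𝓤⁺ ⊔ ℓ)
  isCompact X x = {I : Set u} (U : I → ⟪ X ⟫) → Directed (_≤_ X) U
                  → (W : ⟪ X ⟫) → IsJoin X U W → _≤_ X x W
                  → ∥ Σ I (λ i → _≤_ X x (U i)) ∥

  isFrameHom : ∀ {ℓ ℓ'} (X : Frame ℓ) (Y : Frame ℓ') → (⟪ X ⟫ → ⟪ Y ⟫) → Set 𝓤⁺
  isFrameHom X Y h =
      ((t : ⟪ X ⟫) → IsTop X t → IsTop Y (h t))
    × ((a b m : ⟪ X ⟫) → IsMeet X a b m → IsMeet Y (h a) (h b) (h m))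
    × ({I : Set u} (U : I → ⟪ X ⟫) (m : ⟪ X ⟫) → IsJoin X U m → IsJoin Y (h ∘ U) (h m))

  Pt : ∀ {ℓ} → Frame ℓ → Set 𝓤⁺
  Pt X = Σ (⟪ X ⟫ → Ω) (isFrameHom X ΩFrame)

  isSpectralPoint : ∀ {ℓ} (X : Frame ℓ) → Pt X → Set (𝓤⁺ ⊔ ℓ)
  isSpectralPoint X p = (U : ⟪ X ⟫) → isCompact X U → isCompact ΩFrame (proj₁ p U)

  SpecPt : ∀ {ℓ} → Frame ℓ → Set (𝓤⁺ ⊔ ℓ)
  SpecPt X = Σ (Pt X) (isSpectralPoint X)

  Scott : DCPO → Frame 𝓤⁺
  Scott D = record
    { ⟪_⟫ = Σ (⟨_⟩ → Ω) (isScottOpen D)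
    ; _≤_ = λ U V → (x : ⟨_⟩) → proj₁ U x holds → proj₁ V x holds
    ; IsTop = λ T → proj₁ T ≡ (λ _ → ⊤Ω)
    ; IsMeet = λ U V W → proj₁ W ≡ (λ x → proj₁ U x ∧Ω proj₁ V x)
    ; IsJoin = λ U W → proj₁ W ≡ (λ x → ⋁Ω (λ i → proj₁ (U i) x))
    }
    where open DCPO D

  module _ (X : Frame 𝓤⁺) where
    isScottContinuousNucleus : (⟪ X ⟫ → ⟪ X ⟫) → Set 𝓤⁺
    isScottContinuousNucleus k =
        ((U : ⟪ X ⟫) → _≤_ X U (k U))
      × ((U V W : ⟪ X ⟫) → IsMeet X U V W → IsMeet X (k U) (k V) (k W))
      × ((U : ⟪ X ⟫) → k (k U) ≡ k U)
      × ({I : Set u} (U : I → ⟪ X ⟫) → Directed (_≤_ X) U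
         → (W : ⟪ X ⟫) → IsJoin X U W → IsJoin X (k ∘ U) (k W))

    Nucleus : Set 𝓤⁺
    Nucleus = Σ (⟪ X ⟫ → ⟪ X ⟫) isScottContinuousNucleus

    -- for s = [i₀, …, i_{n-1}] : k_{i_{n-1}} ∘ ⋯ ∘ k_{i₀}
    composeList : {I : Set u} → (I → Nucleus) → List I → ⟪ X ⟫ → ⟪ X ⟫
    composeList ks [] U = U
    composeList ks (i ∷ s) U = composeList ks s (proj₁ (ks i) U)

    Patch : Frame 𝓤⁺
    Patch = record
      { ⟪_⟫ = Nucleus
      ; _≤_ = λ k j → (U : ⟪ X ⟫) → _≤_ X (proj₁ k U) (proj₁ j U)
      ; IsTop = λ t → (U : ⟪ X ⟫) → IsTop X (proj₁ t U)
      ; IsMeet = λ k j m → (U : ⟪ X ⟫) → IsMeet X (proj₁ k U) (proj₁ j U) (proj₁ m U)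
      ; IsJoin = λ ks m → (U : ⟪ X ⟫) → IsJoin X (λ s → composeList ks s U) (proj₁ m U)
      }

{-# OPTIONS --safe #-}
module Submission where

-- A sharp element x gives the spectral point V ↦ (x ∈ V), since every compact Scott open is a finite
-- union ⋃ᶠ l of principal opens of basis elements and x decides membership in it; conversely a
-- spectral point p gives the sharp element ⨆ {b | p ∈ ↑ b}.
--
-- The patch is generated by the nuclei openₙ (⋃ᶠ m) ⊓ closedₙ l below a given nucleus, where closedₙ l
-- is the Heyting implication ⋃ᶠ l ⇒ _, which is Scott continuous thanks to bounded completeness and
-- decidability of upper bounds. As openₙ (⋃ᶠ l) and closedₙ l are complements, every point of the
-- patch decides them. This makes all points of the patch spectral, and lets a point of the patch be
-- recovered from its restriction to the open nuclei, which is a spectral point of Scott D.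

open import Defs
open import Axiom.Extensionality.Propositional using (implicit-extensionality)
open import Axiom.UniquenessOfIdentityProofs using (module Constant⇒UIP)
open import Data.Bool using (Bool; true; false)
open import Data.Empty using (⊥-elim)
open import Data.Empty.Polymorphic using (⊥)
open import Data.List using (List; []; _∷_; _++_; map; [_])
open import Data.List.Membership.Propositional using (find; lose) renaming (_∈_ to _∈ₗ_)
open import Data.List.Membership.Propositional.Properties using (∈-++⁺ˡ; ∈-++⁺ʳ; ∈-++⁻)
open import Data.List.Relation.Unary.All as All using (All; []; _∷_)
import Data.List.Relation.Unary.All.Properties as Allₚ
open import Data.List.Relation.Unary.Any using (here; any?)
open import Data.Product using (Σ; _×_; _,_; proj₁; proj₂)
open import Data.Sum using (_⊎_; inj₁; inj₂)
open import Data.Unit.Polymorphic using (⊤; tt)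
open import Function using (_∘_; id)
open import Level using (Level; Lift; lift; lower)
open import Relation.Nullary using (¬_; Dec; yes; no)
open import Relation.Nullary.Decidable using (map′; _×-dec_; ¬?)
open import Relation.Binary.PropositionalEquality using (_≡_; refl; sym; trans; cong; cong₂; subst)

inverses→≃ : ∀ {a b} {A : Set a} {B : Set b} (f : A → B) (g : B → A)
           → (∀ y → f (g y) ≡ y) → (∀ x → g (f x) ≡ x) → A ≃ B
inverses→≃ f g fg gf = f , (g , fg) , (g , gf)

anyMember? : ∀ {a p} {A : Set a} {P : A → Set p} → (∀ z → Dec (P z))
           → (L : List A) → Dec (Σ (Σ A (_∈ₗ L)) (P ∘ proj₁))
anyMember? P? L = map′ (λ a → let z , z∈L , Pz = find a in (z , z∈L) , Pz)
                       (λ ((z , z∈L) , Pz) → lose z∈L Pz)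
                       (any? P? L)

module Propositions (fe : FunExt) where

  private variable
    a b : Level
    A : Set a

  isProp→isSet : isProp A → isSet A
  isProp→isSet h _ _ = Constant⇒UIP.≡-irrelevant (λ {x} {y} _ → h x y) (λ _ _ → refl)

  isProp-isProp : isProp (isProp A)
  isProp-isProp f g = fe λ x → fe λ y → isProp→isSet f x y (f x y) (g x y)

  Π-isProp : {B : A → Set b} → ((x : A) → isProp (B x)) → isProp ((x : A) → B x)
  Π-isProp h f g = fe λ x → h x (f x) (g x)

  Πᵢ-isProp : {B : A → Set b} → ((x : A) → isProp (B x)) → isProp ({x : A} → B x)
  Πᵢ-isProp h f g = implicit-extensionality fe (h _ f g)

  ×-isProp : {B : Set b} → isProp A → isProp B → isProp (A × B)
  ×-isProp p q (x , y) (x′ , y′) = cong₂ _,_ (p x x′) (q y y′)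

  Σ-≡-prop : {B : A → Set b} → ((x : A) → isProp (B x)) → {s t : Σ A B} → proj₁ s ≡ proj₁ t → s ≡ t
  Σ-≡-prop h {x , _} {.x , _} refl = cong (x ,_) (h x _ _)

  Dec-isProp : isProp A → isProp (Dec A)
  Dec-isProp h (yes x) (yes y) = cong yes (h x y)
  Dec-isProp h (yes x) (no ¬y) = ⊥-elim (¬y x)
  Dec-isProp h (no ¬x) (yes y) = ⊥-elim (¬x y)
  Dec-isProp h (no ¬x) (no ¬y) = cong no (fe λ x → ⊥-elim (¬x x))

module Frames (fe : FunExt) (pe : PropExt) (pt : PropTrunc) (u : Level) where
  open Propositions fe public
  open Theory pt u public

  private variable
    a b : Level
    A : Set a
    B : Set b
    I : Set u

  ∥∥-map : (A → B) → ∥ A ∥ → ∥ B ∥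
  ∥∥-map f = ∥∥-rec ∥∥-isProp (∣_∣ ∘ f)

  ∥∥-bind : ∥ A ∥ → (A → ∥ B ∥) → ∥ B ∥
  ∥∥-bind x f = ∥∥-rec ∥∥-isProp f x

  ∥∥-dec : Dec A → Dec ∥ A ∥
  ∥∥-dec (yes x) = yes ∣ x ∣
  ∥∥-dec (no ¬x) = no (∥∥-rec (λ ()) ¬x)

  𝟚 : Set u
  𝟚 = Lift u Bool

  pair : A → A → 𝟚 → A
  pair x y (lift true) = x
  pair x y (lift false) = y

  holds-isProp : (P : Ω) → isProp (P holds)
  holds-isProp = proj₂

  Ω-ext : {P Q : Ω} → (P holds → Q holds) → (Q holds → P holds) → P ≡ Q
  Ω-ext {_ , p} {_ , q} f g = Σ-≡-prop (λ _ → isProp-isProp) (pe p q f g)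

  Ω-funext : {F G : A → Ω} → (∀ x → F x holds → G x holds) → (∀ x → G x holds → F x holds) → F ≡ G
  Ω-funext f g = fe λ x → Ω-ext (f x) (g x)

  Ω-isSet : isSet Ω
  Ω-isSet _ _ = Constant⇒UIP.≡-irrelevant collapse collapse-constant
    where
    collapse : {P Q : Ω} → P ≡ Q → P ≡ Q
    collapse e = Ω-ext (subst _holds e) (subst _holds (sym e))

    collapse-constant : {P Q : Ω} (e e′ : P ≡ Q) → collapse e ≡ collapse e′
    collapse-constant {P} {Q} _ _ =
      cong₂ (Ω-ext {P} {Q}) (fe λ _ → holds-isProp Q _ _) (fe λ _ → holds-isProp P _ _)

  ⊥Ω : Ω
  ⊥Ω = ⊥ , λ ()

  decidable→compact : (P : Ω) → Dec (P holds) → isCompact ΩFrame P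
  decidable→compact P (yes p) U δ W refl P≤W = ∥∥-map (λ (i , Uᵢ) → i , λ _ → Uᵢ) (P≤W p)
  decidable→compact P (no ¬p) U δ W _ _ = ∥∥-map (λ i → i , ⊥-elim ∘ ¬p) (proj₁ δ)

  -- P is below the directed join of ⊥ and the copies of ⊤ indexed by P itself.
  compact→decidable : (P : Ω) → isCompact ΩFrame P → Dec (P holds)
  compact→decidable P c =
    ∥∥-rec (Dec-isProp (holds-isProp P)) decide (c Q Q-directed (⋁Ω Q) refl λ p → ∣ inj₁ p , tt ∣)
    where
    Q : P holds ⊎ ⊤ {u} → Ω
    Q (inj₁ _) = ⊤Ω
    Q (inj₂ _) = ⊥Ω

    Q-upper : (i j : P holds ⊎ ⊤) → ∥ Σ _ (λ k → (Q i holds → Q k holds) × (Q j holds → Q k holds)) ∥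
    Q-upper (inj₁ p) _ = ∣ inj₁ p , id , _ ∣
    Q-upper (inj₂ _) (inj₁ p) = ∣ inj₁ p , _ , id ∣
    Q-upper (inj₂ t) (inj₂ _) = ∣ inj₂ t , id , id ∣

    Q-directed : Directed (_≤_ ΩFrame) Q
    Q-directed = ∣ inj₂ tt ∣ , Q-upper

    decide : Σ _ (λ i → P holds → Q i holds) → Dec (P holds)
    decide (inj₁ p , _) = yes p
    decide (inj₂ _ , P≤⊥) = no (lower ∘ P≤⊥)

  module Points {ℓ} (Y : Frame ℓ) where

    _∈ₚ_ : Pt Y → ⟪ Y ⟫ → Set u
    p ∈ₚ U = proj₁ p U holds

    infix 4 _∈ₚ_

    module _ (p : Pt Y) where
      private
        preservesTop = proj₁ (proj₂ p)
        preservesMeet = proj₁ (proj₂ (proj₂ p))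
        preservesJoin = proj₂ (proj₂ (proj₂ p))

      ∈ₚ-isProp : (U : ⟪ Y ⟫) → isProp (p ∈ₚ U)
      ∈ₚ-isProp U = holds-isProp (proj₁ p U)

      ∈ₚ-top : {t : ⟪ Y ⟫} → IsTop Y t → p ∈ₚ t
      ∈ₚ-top e = subst _holds (sym (preservesTop _ e)) tt

      ∈ₚ-meet⁻ : {a b m : ⟪ Y ⟫} → IsMeet Y a b m → p ∈ₚ m → p ∈ₚ a × p ∈ₚ b
      ∈ₚ-meet⁻ e = subst _holds (preservesMeet _ _ _ e)

      ∈ₚ-meet⁺ : {a b m : ⟪ Y ⟫} → IsMeet Y a b m → p ∈ₚ a → p ∈ₚ b → p ∈ₚ m
      ∈ₚ-meet⁺ e x y = subst _holds (sym (preservesMeet _ _ _ e)) (x , y)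

      ∈ₚ-join⁻ : {U : I → ⟪ Y ⟫} {m : ⟪ Y ⟫} → IsJoin Y U m → p ∈ₚ m → ∥ Σ I (λ i → p ∈ₚ U i) ∥
      ∈ₚ-join⁻ e = subst _holds (preservesJoin _ _ e)

      ∈ₚ-join⁺ : {U : I → ⟪ Y ⟫} {m : ⟪ Y ⟫} → IsJoin Y U m → (i : I) → p ∈ₚ U i → p ∈ₚ m
      ∈ₚ-join⁺ e i x = subst _holds (sym (preservesJoin _ _ e)) ∣ i , x ∣

      ∈ₚ-mono : {a b : ⟪ Y ⟫} → IsMeet Y a b a → p ∈ₚ a → p ∈ₚ b
      ∈ₚ-mono e = proj₂ ∘ ∈ₚ-meet⁻ e

      ∉ₚ-emptyJoin : {U : I → ⟪ Y ⟫} {m : ⟪ Y ⟫} → ¬ I → IsJoin Y U m → ¬ (p ∈ₚ m)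
      ∉ₚ-emptyJoin ¬I e x = ∥∥-rec (λ ()) (¬I ∘ proj₁) (∈ₚ-join⁻ e x)

      decidable→spectral : ((U : ⟪ Y ⟫) → isCompact Y U → Dec (p ∈ₚ U)) → isSpectralPoint Y p
      decidable→spectral d U c = decidable→compact (proj₁ p U) (d U c)

      spectral→decidable : isSpectralPoint Y p → (U : ⟪ Y ⟫) → isCompact Y U → Dec (p ∈ₚ U)
      spectral→decidable s U c = compact→decidable (proj₁ p U) (s U c)

    isFrameHom-isProp : (h : ⟪ Y ⟫ → Ω) → isProp (isFrameHom Y ΩFrame h)
    isFrameHom-isProp h =
      ×-isProp (Π-isProp λ _ → Π-isProp λ _ → Ω-isSet _ _)
        (×-isProp (Π-isProp λ _ → Π-isProp λ _ → Π-isProp λ _ → Π-isProp λ _ → Ω-isSet _ _)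
          (Πᵢ-isProp λ _ → Π-isProp λ _ → Π-isProp λ _ → Π-isProp λ _ → Ω-isSet _ _))

    isSpectralPoint-isProp : (p : Pt Y) → isProp (isSpectralPoint Y p)
    isSpectralPoint-isProp p =
      Π-isProp λ _ → Π-isProp λ _ → Πᵢ-isProp λ _ → Π-isProp λ _ → Π-isProp λ _ →
      Π-isProp λ _ → Π-isProp λ _ → Π-isProp λ _ → ∥∥-isProp

    Pt-ext : {p q : Pt Y} → (∀ U → p ∈ₚ U → q ∈ₚ U) → (∀ U → q ∈ₚ U → p ∈ₚ U) → p ≡ q
    Pt-ext f g = Σ-≡-prop isFrameHom-isProp (Ω-funext f g)

    SpecPt-ext : {p q : SpecPt Y} → (∀ U → proj₁ p ∈ₚ U → proj₁ q ∈ₚ U) → (∀ U → proj₁ q ∈ₚ U → proj₁ p ∈ₚ U)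
               → p ≡ q
    SpecPt-ext f g = Σ-≡-prop isSpectralPoint-isProp (Pt-ext f g)

    SpecPt≃Pt : ((p : Pt Y) → isSpectralPoint Y p) → SpecPt Y ≃ Pt Y
    SpecPt≃Pt spectral = inverses→≃ proj₁ (λ p → p , spectral p) (λ _ → refl)
      (λ (p , s) → cong (p ,_) (isSpectralPoint-isProp p _ s))

    Pt-precompose : ∀ {ℓ′} {Z : Frame ℓ′} (f : ⟪ Z ⟫ → ⟪ Y ⟫) → isFrameHom Z Y f → Pt Y → Pt Z
    Pt-precompose f (fTop , fMeet , fJoin) (p , pTop , pMeet , pJoin) =
      p ∘ f ,
      (λ t e → pTop (f t) (fTop t e)) ,
      (λ a b m e → pMeet (f a) (f b) (f m) (fMeet a b m e)) ,
      (λ U m e → pJoin (f ∘ U) (f m) (fJoin U m e))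

module ScottOpens (fe : FunExt) (pe : PropExt) (pt : PropTrunc) (u : Level) (D : Theory.DCPO pt u) where
  open Frames fe pe pt u public
  open DCPO D public

  private variable
    I : Set u
    x y : ⟨_⟩

  𝕆 : Set 𝓤⁺
  𝕆 = ⟪ Scott D ⟫

  _∈_ : ⟨_⟩ → 𝕆 → Set u
  x ∈ V = proj₁ V x holds

  _⊆_ : 𝕆 → 𝕆 → Set 𝓤⁺
  _⊆_ = _≤_ (Scott D)

  infix 4 _∈_ _⊆_

  ∈-isProp : (x : ⟨_⟩) (V : 𝕆) → isProp (x ∈ V)
  ∈-isProp x V = holds-isProp (proj₁ V x)

  ∈-upward : (V : 𝕆) → x ∈ V → x ⊑ y → y ∈ V
  ∈-upward V = proj₁ (proj₂ V) _ _

  ∈-inaccessible : (V : 𝕆) (α : I → ⟨_⟩) (δ : Directed _⊑_ α) → ⨆ α δ ∈ V → ∥ Σ I (λ i → α i ∈ V) ∥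
  ∈-inaccessible V = proj₂ (proj₂ V)

  ⊑-trans′ : x ⊑ y → {z : ⟨_⟩} → y ⊑ z → x ⊑ z
  ⊑-trans′ p q = ⊑-trans _ _ _ p q

  isScottOpen-isProp : (U : ⟨_⟩ → Ω) → isProp (isScottOpen D U)
  isScottOpen-isProp U =
    ×-isProp (Π-isProp λ _ → Π-isProp λ y → Π-isProp λ _ → Π-isProp λ _ → holds-isProp (U y))
             (Πᵢ-isProp λ _ → Π-isProp λ _ → Π-isProp λ _ → Π-isProp λ _ → ∥∥-isProp)

  ⊆-antisym : {A B : 𝕆} → A ⊆ B → B ⊆ A → A ≡ B
  ⊆-antisym f g = Σ-≡-prop isScottOpen-isProp (Ω-funext f g)

  isTop-intro : {T : 𝕆} → (∀ x → x ∈ T) → IsTop (Scott D) T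
  isTop-intro f = Ω-funext (λ _ _ → tt) (λ x _ → f x)

  isTop-∈ : {T : 𝕆} → IsTop (Scott D) T → (x : ⟨_⟩) → x ∈ T
  isTop-∈ e x = subst (λ F → F x holds) (sym e) tt

  isMeet-intro : {A B C : 𝕆} → (∀ x → x ∈ C → x ∈ A × x ∈ B) → (∀ x → x ∈ A → x ∈ B → x ∈ C)
               → IsMeet (Scott D) A B C
  isMeet-intro f g = Ω-funext f (λ x (a , b) → g x a b)

  isMeet-∈⁻ : {A B C : 𝕆} → IsMeet (Scott D) A B C → x ∈ C → x ∈ A × x ∈ B
  isMeet-∈⁻ {x = x} e = subst (λ F → F x holds) e

  isMeet-∈⁺ : {A B C : 𝕆} → IsMeet (Scott D) A B C → x ∈ A → x ∈ B → x ∈ C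
  isMeet-∈⁺ {x = x} e a b = subst (λ F → F x holds) (sym e) (a , b)

  isMeet-⊆ˡ : {A B C : 𝕆} → IsMeet (Scott D) A B C → C ⊆ A
  isMeet-⊆ˡ {A} {B} {C} e _ = proj₁ ∘ isMeet-∈⁻ {A = A} {B} {C} e

  isMeet-⊆ʳ : {A B C : 𝕆} → IsMeet (Scott D) A B C → C ⊆ B
  isMeet-⊆ʳ {A} {B} {C} e _ = proj₂ ∘ isMeet-∈⁻ {A = A} {B} {C} e

  ⊆→isMeet : {A B : 𝕆} → A ⊆ B → IsMeet (Scott D) A B A
  ⊆→isMeet {A} {B} A⊆B = isMeet-intro {A} {B} {A} (λ x a → a , A⊆B x a) (λ _ a _ → a)

  isJoin-intro : {U : I → 𝕆} {W : 𝕆} → (∀ x → x ∈ W → ∥ Σ I (λ i → x ∈ U i) ∥) → (∀ i → U i ⊆ W)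
               → IsJoin (Scott D) U W
  isJoin-intro {W = W} f g = Ω-funext f (λ x → ∥∥-rec (∈-isProp x W) λ (i , a) → g i x a)

  isJoin-∈⁻ : {U : I → 𝕆} {W : 𝕆} → IsJoin (Scott D) U W → x ∈ W → ∥ Σ I (λ i → x ∈ U i) ∥
  isJoin-∈⁻ {x = x} e = subst (λ F → F x holds) e

  isJoin-upper : {U : I → 𝕆} {W : 𝕆} → IsJoin (Scott D) U W → (i : I) → U i ⊆ W
  isJoin-upper e i x a = subst (λ F → F x holds) (sym e) ∣ i , a ∣

  ⊤ₒ : 𝕆
  ⊤ₒ = (λ _ → ⊤Ω) , (λ _ _ _ _ → tt) , (λ _ δ _ → ∥∥-map (λ i → i , tt) (proj₁ δ))

  _∩_ : 𝕆 → 𝕆 → 𝕆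
  V ∩ W = (λ x → proj₁ V x ∧Ω proj₁ W x) ,
          (λ _ _ (v , w) x⊑y → ∈-upward V v x⊑y , ∈-upward W w x⊑y) ,
          (λ α δ (v , w) → ∥∥-bind (∈-inaccessible V α δ v) λ (i , vᵢ) →
                           ∥∥-bind (∈-inaccessible W α δ w) λ (j , wⱼ) →
                           ∥∥-map (λ (k , i≤k , j≤k) → k , ∈-upward V vᵢ i≤k , ∈-upward W wⱼ j≤k) (proj₂ δ i j))

  ⋃ : (I → 𝕆) → 𝕆
  ⋃ {I} U = (λ x → ⋁Ω (λ i → proj₁ (U i) x)) ,
            (λ _ _ u x⊑y → ∥∥-map (λ (i , uᵢ) → i , ∈-upward (U i) uᵢ x⊑y) u) ,
            (λ α δ u → ∥∥-bind u λ (i , uᵢ) → ∥∥-map (λ (j , a) → j , ∣ i , a ∣) (∈-inaccessible (U i) α δ uᵢ))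

  _∪_ : 𝕆 → 𝕆 → 𝕆
  V ∪ W = ⋃ (pair V W)

  infixr 7 _∩_
  infixr 6 _∪_

  ∪-inl : {V W : 𝕆} → x ∈ V → x ∈ V ∪ W
  ∪-inl v = ∣ lift true , v ∣

  ∪-inr : {V W : 𝕆} → x ∈ W → x ∈ V ∪ W
  ∪-inr w = ∣ lift false , w ∣

  ∪-rec : ∀ {ℓ} {P : Set ℓ} {V W : 𝕆} → isProp P → (x ∈ V → P) → (x ∈ W → P) → x ∈ V ∪ W → P
  ∪-rec P-isProp f g = ∥∥-rec P-isProp (λ { (lift true , v) → f v ; (lift false , w) → g w })

  ∪-monotoneʳ : {V A B : 𝕆} → A ⊆ B → V ∪ A ⊆ V ∪ B
  ∪-monotoneʳ {V} A⊆B x = ∪-rec {V = V} ∥∥-isProp (∪-inl {V = V}) (∪-inr {V = V} ∘ A⊆B x)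

  ∪-monotoneˡ : {V A B : 𝕆} → A ⊆ B → A ∪ V ⊆ B ∪ V
  ∪-monotoneˡ {V} {A} {B} A⊆B x = ∪-rec {V = A} ∥∥-isProp (∪-inl {V = B} ∘ A⊆B x) (∪-inr {V = B})

  monotone-directed : {U : I → 𝕆} (f : 𝕆 → 𝕆) → (∀ {A B} → A ⊆ B → f A ⊆ f B)
                    → Directed _⊆_ U → Directed _⊆_ (f ∘ U)
  monotone-directed f f-mono (inhabited , upper) =
    inhabited , λ i j → ∥∥-map (λ (k , i≤k , j≤k) → k , f-mono i≤k , f-mono j≤k) (upper i j)

  directed-All : ∀ {a b} {A : Set a} {Q : A → 𝕆 → Set b} {U : I → 𝕆} → Directed _⊆_ U
               → (∀ z {V W} → V ⊆ W → Q z V → Q z W)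
               → (l : List A) → All (λ z → ∥ Σ I (λ i → Q z (U i)) ∥) l → ∥ Σ I (λ i → All (λ z → Q z (U i)) l) ∥
  directed-All δ Q-mono [] [] = ∥∥-map (λ i → i , []) (proj₁ δ)
  directed-All δ Q-mono (z ∷ l) (qz ∷ ql) =
    ∥∥-bind qz λ (i , q) →
    ∥∥-bind (directed-All δ Q-mono l ql) λ (j , qs) →
    ∥∥-map (λ (k , i≤k , j≤k) → k , Q-mono z i≤k q ∷ All.map (Q-mono _ j≤k) qs) (proj₂ δ i j)

module ScottNuclei (fe : FunExt) (pe : PropExt) (pt : PropTrunc) (u : Level) (D : Theory.DCPO pt u) where
  open ScottOpens fe pe pt u D public

  private variable
    I J : Set u
    x : ⟨_⟩

  PX : Frame 𝓤⁺
  PX = Patch (Scott D)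

  Nuc : Set 𝓤⁺
  Nuc = Nucleus (Scott D)

  _·_ : Nuc → 𝕆 → 𝕆
  k · V = proj₁ k V

  _≤ₙ_ : Nuc → Nuc → Set 𝓤⁺
  _≤ₙ_ = _≤_ PX

  infixr 9 _·_
  infix 4 _≤ₙ_

  module _ (k : Nuc) where
    ·-inflationary : (V : 𝕆) → V ⊆ k · V
    ·-inflationary = proj₁ (proj₂ k)

    ·-preservesMeet : {A B C : 𝕆} → IsMeet (Scott D) A B C → IsMeet (Scott D) (k · A) (k · B) (k · C)
    ·-preservesMeet = proj₁ (proj₂ (proj₂ k)) _ _ _

    ·-idempotent : (V : 𝕆) → k · k · V ≡ k · V
    ·-idempotent = proj₁ (proj₂ (proj₂ (proj₂ k)))

    ·-preservesDirectedJoin : {U : I → 𝕆} → Directed _⊆_ U → {W : 𝕆} → IsJoin (Scott D) U W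
                            → IsJoin (Scott D) (λ i → k · U i) (k · W)
    ·-preservesDirectedJoin δ = proj₂ (proj₂ (proj₂ (proj₂ k))) _ δ _

    ·-monotone : {A B : 𝕆} → A ⊆ B → k · A ⊆ k · B
    ·-monotone {A} {B} A⊆B = isMeet-⊆ʳ {k · A} {k · B} {k · A} (·-preservesMeet (⊆→isMeet {A} {B} A⊆B))

    ·-∩ : (A B : 𝕆) → x ∈ k · A → x ∈ k · B → x ∈ k · (A ∩ B)
    ·-∩ A B = isMeet-∈⁺ {A = k · A} {k · B} {k · (A ∩ B)} (·-preservesMeet {A} {B} {A ∩ B} refl)

  ≤ₙ→isMeet : {k j : Nuc} → k ≤ₙ j → IsMeet PX k j k
  ≤ₙ→isMeet {k} {j} k≤j V = ⊆→isMeet {k · V} {j · V} (k≤j V)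

  module Joins {I : Set u} (ks : I → Nuc) where

    _⋆_ : List I → 𝕆 → 𝕆
    _⋆_ = composeList (Scott D) ks

    ⋆-monotone : (s : List I) {A B : 𝕆} → A ⊆ B → s ⋆ A ⊆ s ⋆ B
    ⋆-monotone [] A⊆B = A⊆B
    ⋆-monotone (i ∷ s) A⊆B = ⋆-monotone s (·-monotone (ks i) A⊆B)

    ⋆-inflationary : (s : List I) (V : 𝕆) → V ⊆ s ⋆ V
    ⋆-inflationary [] V x v = v
    ⋆-inflationary (i ∷ s) V x v = ⋆-inflationary s (ks i · V) x (·-inflationary (ks i) V x v)

    ⋆-preservesMeet : (s : List I) {A B C : 𝕆} → IsMeet (Scott D) A B C → IsMeet (Scott D) (s ⋆ A) (s ⋆ B) (s ⋆ C)
    ⋆-preservesMeet [] e = e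
    ⋆-preservesMeet (i ∷ s) e = ⋆-preservesMeet s (·-preservesMeet (ks i) e)

    ⋆-preservesDirectedJoin : (s : List I) {U : J → 𝕆} → Directed _⊆_ U → {W : 𝕆} → IsJoin (Scott D) U W
                            → IsJoin (Scott D) (λ j → s ⋆ U j) (s ⋆ W)
    ⋆-preservesDirectedJoin [] δ e = e
    ⋆-preservesDirectedJoin (i ∷ s) δ e =
      ⋆-preservesDirectedJoin s (monotone-directed (ks i ·_) (·-monotone (ks i)) δ)
                                (·-preservesDirectedJoin (ks i) δ e)

    ⋆-++ : (s t : List I) (V : 𝕆) → (s ++ t) ⋆ V ≡ t ⋆ (s ⋆ V)
    ⋆-++ [] t V = refl
    ⋆-++ (i ∷ s) t V = ⋆-++ s t (ks i · V)

    ⋆-++ˡ : (s t : List I) (V : 𝕆) → s ⋆ V ⊆ (s ++ t) ⋆ V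
    ⋆-++ˡ s t V x v = subst (x ∈_) (sym (⋆-++ s t V)) (⋆-inflationary t (s ⋆ V) x v)

    ⋆-++ʳ : (s t : List I) (V : 𝕆) → t ⋆ V ⊆ (s ++ t) ⋆ V
    ⋆-++ʳ s t V x v = subst (x ∈_) (sym (⋆-++ s t V)) (⋆-monotone t (⋆-inflationary s V) x v)

    ⋆-directed : (V : 𝕆) → Directed _⊆_ (_⋆ V)
    ⋆-directed V = ∣ [] ∣ , λ s t → ∣ s ++ t , ⋆-++ˡ s t V , ⋆-++ʳ s t V ∣

    ⋆-least : (k : Nuc) → (∀ i → ks i ≤ₙ k) → (s : List I) (V : 𝕆) → s ⋆ V ⊆ k · V
    ⋆-least k ks≤k [] V = ·-inflationary k V
    ⋆-least k ks≤k (i ∷ s) V x v =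
      subst (x ∈_) (·-idempotent k V) (·-monotone k (ks≤k i V) x (⋆-least k ks≤k s (ks i · V) x v))

    joinMap : 𝕆 → 𝕆
    joinMap V = ⋃ (_⋆ V)

    joinMap-monotone : {A B : 𝕆} → A ⊆ B → joinMap A ⊆ joinMap B
    joinMap-monotone A⊆B x = ∥∥-map λ (s , a) → s , ⋆-monotone s A⊆B x a

    joinMap-preservesMeet : {A B C : 𝕆} → IsMeet (Scott D) A B C
                          → IsMeet (Scott D) (joinMap A) (joinMap B) (joinMap C)
    joinMap-preservesMeet {A} {B} {C} e = isMeet-intro {joinMap A} {joinMap B} {joinMap C}
      (λ x c → joinMap-monotone (isMeet-⊆ˡ {A} {B} {C} e) x c ,
               joinMap-monotone (isMeet-⊆ʳ {A} {B} {C} e) x c)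
      (λ x a b → ∥∥-bind a λ (s , a) → ∥∥-map (λ (t , b) →
        s ++ t , isMeet-∈⁺ {A = (s ++ t) ⋆ A} {(s ++ t) ⋆ B} {(s ++ t) ⋆ C} (⋆-preservesMeet (s ++ t) e)
                           (⋆-++ˡ s t A x a) (⋆-++ʳ s t B x b)) b)

    -- s ⋆ joinMap V is the directed join of the (t ++ s) ⋆ V.
    joinMap-idempotent : (V : 𝕆) → joinMap (joinMap V) ≡ joinMap V
    joinMap-idempotent V = ⊆-antisym
      (λ x a → ∥∥-bind a λ (s , b) →
        ∥∥-map (λ (t , c) → t ++ s , subst (x ∈_) (sym (⋆-++ t s V)) c)
               (isJoin-∈⁻ {U = λ t → s ⋆ (t ⋆ V)} {s ⋆ joinMap V}
                          (⋆-preservesDirectedJoin s (⋆-directed V) {joinMap V} refl) b))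
      (λ x a → ∣ [] , a ∣)

    joinMap-preservesDirectedJoin : {U : J → 𝕆} → Directed _⊆_ U → {W : 𝕆} → IsJoin (Scott D) U W
                                  → IsJoin (Scott D) (joinMap ∘ U) (joinMap W)
    joinMap-preservesDirectedJoin {U = U} δ {W} e = isJoin-intro {U = joinMap ∘ U} {joinMap W}
      (λ x a → ∥∥-bind a λ (s , b) →
        ∥∥-map (λ (j , c) → j , ∣ s , c ∣)
               (isJoin-∈⁻ {U = λ j → s ⋆ U j} {s ⋆ W} (⋆-preservesDirectedJoin s δ e) b))
      (λ j → joinMap-monotone {U j} {W} (isJoin-upper {U = U} {W} e j))

    ⋁ₙ : Nuc
    ⋁ₙ = joinMap ,
         (λ V x v → ∣ [] , v ∣) ,
         (λ _ _ _ → joinMap-preservesMeet) ,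
         joinMap-idempotent ,
         (λ _ δ _ → joinMap-preservesDirectedJoin δ)

    ⋁ₙ-isJoin : IsJoin PX ks ⋁ₙ
    ⋁ₙ-isJoin V = refl

    ⋁ₙ-least : (k : Nuc) → (∀ i → ks i ≤ₙ k) → ⋁ₙ ≤ₙ k
    ⋁ₙ-least k ks≤k V x = ∥∥-rec (∈-isProp x (k · V)) λ (s , v) → ⋆-least k ks≤k s V x v

  open Joins using (⋁ₙ; ⋁ₙ-isJoin; ⋁ₙ-least) public

  composeList-map : {ks : J → Nuc} (f : I → J) (s : List I) (V : 𝕆)
                  → composeList (Scott D) ks (map f s) V ≡ composeList (Scott D) (ks ∘ f) s V
  composeList-map f [] V = refl
  composeList-map {ks = ks} f (i ∷ s) V = composeList-map f s (ks (f i) · V)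

  ⋁ₙ-reindex : (ks : J → Nuc) (f : I → J) → ⋁ₙ (ks ∘ f) ≤ₙ ⋁ₙ ks
  ⋁ₙ-reindex ks f V x = ∥∥-map λ (s , v) → map f s , subst (x ∈_) (sym (composeList-map f s V)) v

  ⊥ₙ : Nuc
  ⊥ₙ = ⋁ₙ {I = ⊥} λ ()

  ⊤ₙ : Nuc
  ⊤ₙ = (λ _ → ⊤ₒ) ,
       (λ _ _ _ → tt) ,
       (λ _ _ _ _ → isMeet-intro {⊤ₒ} {⊤ₒ} {⊤ₒ} (λ _ _ → tt , tt) (λ _ _ _ → tt)) ,
       (λ _ → refl) ,
       (λ U δ _ _ → isJoin-intro {U = λ _ → ⊤ₒ} {W = ⊤ₒ} (λ _ _ → ∥∥-map (λ i → i , tt) (proj₁ δ)) (λ _ _ _ → tt))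

  ⊤ₙ-isTop : IsTop PX ⊤ₙ
  ⊤ₙ-isTop V = refl

  module _ (k j : Nuc) where
    private
      k⊓j : 𝕆 → 𝕆
      k⊓j V = k · V ∩ j · V

    ⊓-preservesMeet : {A B C : 𝕆} → IsMeet (Scott D) A B C → IsMeet (Scott D) (k⊓j A) (k⊓j B) (k⊓j C)
    ⊓-preservesMeet {A} {B} {C} e = isMeet-intro {k⊓j A} {k⊓j B} {k⊓j C}
      (λ x (kc , jc) →
        let ka , kb = isMeet-∈⁻ {A = k · A} {k · B} {k · C} (·-preservesMeet k e) kc
            ja , jb = isMeet-∈⁻ {A = j · A} {j · B} {j · C} (·-preservesMeet j e) jc
        in (ka , ja) , (kb , jb))
      (λ x (ka , ja) (kb , jb) →
        isMeet-∈⁺ {A = k · A} {k · B} {k · C} (·-preservesMeet k e) ka kb ,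
        isMeet-∈⁺ {A = j · A} {j · B} {j · C} (·-preservesMeet j e) ja jb)

    ⊓-idempotent : (V : 𝕆) → k⊓j (k⊓j V) ≡ k⊓j V
    ⊓-idempotent V = ⊆-antisym
      (λ x (a , b) → subst (x ∈_) (·-idempotent k V) (·-monotone k (λ _ → proj₁) x a) ,
                     subst (x ∈_) (·-idempotent j V) (·-monotone j (λ _ → proj₂) x b))
      (λ x (kv , jv) →
        ·-∩ k (k · V) (j · V) (·-inflationary k (k · V) x kv) (·-inflationary k (j · V) x jv) ,
        ·-∩ j (k · V) (j · V) (·-inflationary j (k · V) x kv) (·-inflationary j (j · V) x jv))

    ⊓-preservesDirectedJoin : {U : I → 𝕆} → Directed _⊆_ U → {W : 𝕆} → IsJoin (Scott D) U W
                            → IsJoin (Scott D) (k⊓j ∘ U) (k⊓j W)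
    ⊓-preservesDirectedJoin {U = U} δ {W} e = isJoin-intro {U = k⊓j ∘ U} {k⊓j W}
      (λ x (kw , jw) →
        ∥∥-bind (isJoin-∈⁻ {U = λ i → k · U i} {k · W} (·-preservesDirectedJoin k δ e) kw) λ (i , a) →
        ∥∥-bind (isJoin-∈⁻ {U = λ i → j · U i} {j · W} (·-preservesDirectedJoin j δ e) jw) λ (i′ , b) →
        ∥∥-map (λ (m , i≤m , i′≤m) → m , ·-monotone k i≤m x a , ·-monotone j i′≤m x b) (proj₂ δ i i′))
      (λ i x (a , b) → ·-monotone k (isJoin-upper {U = U} {W} e i) x a ,
                       ·-monotone j (isJoin-upper {U = U} {W} e i) x b)

    _⊓_ : Nuc
    _⊓_ = k⊓j ,
          (λ V x v → ·-inflationary k V x v , ·-inflationary j V x v) ,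
          (λ _ _ _ → ⊓-preservesMeet) ,
          ⊓-idempotent ,
          (λ _ δ _ → ⊓-preservesDirectedJoin δ)

    ⊓-isMeet : IsMeet PX k j _⊓_
    ⊓-isMeet V = refl

  module _ (V : 𝕆) where
    ∪-preservesMeet : {A B C : 𝕆} → IsMeet (Scott D) A B C → IsMeet (Scott D) (V ∪ A) (V ∪ B) (V ∪ C)
    ∪-preservesMeet {A} {B} {C} e = isMeet-intro {V ∪ A} {V ∪ B} {V ∪ C}
      (λ x c → ∪-monotoneʳ {V} (isMeet-⊆ˡ {A} {B} {C} e) x c ,
               ∪-monotoneʳ {V} (isMeet-⊆ʳ {A} {B} {C} e) x c)
      (λ x → ∪-rec {V = V} (Π-isProp λ _ → ∥∥-isProp) (λ v _ → ∪-inl {V = V} v) λ a →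
             ∪-rec {V = V} ∥∥-isProp (∪-inl {V = V}) (∪-inr {V = V} ∘ isMeet-∈⁺ {A = A} {B} {C} e a))

    ∪-idempotent : (W : 𝕆) → V ∪ V ∪ W ≡ V ∪ W
    ∪-idempotent W = ⊆-antisym (λ x → ∪-rec {V = V} ∥∥-isProp (∪-inl {V = V}) id) (λ x → ∪-inr {V = V})

    ∪-preservesDirectedJoin : {U : I → 𝕆} → Directed _⊆_ U → {W : 𝕆} → IsJoin (Scott D) U W
                            → IsJoin (Scott D) (λ i → V ∪ U i) (V ∪ W)
    ∪-preservesDirectedJoin {U = U} δ {W} e = isJoin-intro {U = λ i → V ∪ U i} {V ∪ W}
      (λ x → ∪-rec {V = V} ∥∥-isProp (λ v → ∥∥-map (λ i → i , ∪-inl {V = V} v) (proj₁ δ))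
                                     (∥∥-map (λ (i , w) → i , ∪-inr {V = V} w) ∘ isJoin-∈⁻ {U = U} {W} e))
      (λ i → ∪-monotoneʳ {V} (isJoin-upper {U = U} {W} e i))

    openₙ : Nuc
    openₙ = (V ∪_) ,
            (λ W x → ∪-inr {V = V}) ,
            (λ _ _ _ → ∪-preservesMeet) ,
            ∪-idempotent ,
            (λ _ δ _ → ∪-preservesDirectedJoin δ)

  openₙ-monotone : {A B : 𝕆} → A ⊆ B → openₙ A ≤ₙ openₙ B
  openₙ-monotone {A} {B} A⊆B V = ∪-monotoneˡ {V} {A} {B} A⊆B

  open⋆⊆ : {U : I → 𝕆} {W : 𝕆} → (∀ i → U i ⊆ W) → (s : List I) (V : 𝕆)
         → composeList (Scott D) (openₙ ∘ U) s V ⊆ W ∪ V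
  open⋆⊆ {W = W} U⊆W [] V x = ∪-inr {V = W}
  open⋆⊆ {U = U} {W} U⊆W (i ∷ s) V x a =
    ∪-rec {V = W} ∥∥-isProp (∪-inl {V = W}) (∪-monotoneˡ {V} {U i} {W} (U⊆W i) x) (open⋆⊆ U⊆W s (U i ∪ V) x a)

  openₙ-isFrameHom : isFrameHom (Scott D) PX openₙ
  openₙ-isFrameHom = preservesTop , preservesMeet , preservesJoin
    where
    preservesTop : (T : 𝕆) → IsTop (Scott D) T → IsTop PX (openₙ T)
    preservesTop T e V = isTop-intro {T ∪ V} λ x → ∪-inl {V = T} (isTop-∈ {T} e x)

    preservesMeet : (A B C : 𝕆) → IsMeet (Scott D) A B C → IsMeet PX (openₙ A) (openₙ B) (openₙ C)
    preservesMeet A B C e V = isMeet-intro {A ∪ V} {B ∪ V} {C ∪ V}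
      (λ x c → ∪-monotoneˡ {V} {C} {A} (isMeet-⊆ˡ {A} {B} {C} e) x c ,
               ∪-monotoneˡ {V} {C} {B} (isMeet-⊆ʳ {A} {B} {C} e) x c)
      (λ x → ∪-rec {V = A} (Π-isProp λ _ → ∥∥-isProp)
               (λ a → ∪-rec {V = B} ∥∥-isProp (∪-inl {V = C} ∘ isMeet-∈⁺ {A = A} {B} {C} e a) (∪-inr {V = C}))
               (λ v _ → ∪-inr {V = C} v))

    preservesJoin : {I : Set u} (U : I → 𝕆) (W : 𝕆) → IsJoin (Scott D) U W → IsJoin PX (openₙ ∘ U) (openₙ W)
    preservesJoin U W e V = isJoin-intro {U = λ s → composeList (Scott D) (openₙ ∘ U) s V} {W ∪ V}
      (λ x → ∪-rec {V = W} ∥∥-isProp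
               (∥∥-map (λ (i , a) → [ i ] , ∪-inl {V = U i} a) ∘ isJoin-∈⁻ {U = U} {W} e)
               (λ v → ∣ [] , v ∣))
      (λ s → open⋆⊆ (isJoin-upper {U = U} {W} e) s V)

module ScottDomainBasis (fe : FunExt) (pe : PropExt) (pt : PropTrunc) (u : Level) (SD : Theory.ScottDomain pt u) where
  open Theory.ScottDomain {pt} {u} SD
  open ScottNuclei fe pe pt u dcpo public

  D : DCPO
  D = dcpo

  private variable
    I : Set u
    x y : ⟨_⟩

  𝔹 : Set u
  𝔹 = proj₁ (proj₂ algebraic)

  private
    𝔹≃K : 𝔹 ≃ K D
    𝔹≃K = proj₂ (proj₂ algebraic)

  ι : 𝔹 → ⟨_⟩
  ι b = proj₁ (proj₁ 𝔹≃K b)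

  ι-finite : (b : 𝔹) → isFinite D (ι b)
  ι-finite b = proj₂ (proj₁ 𝔹≃K b)

  basisIndex : (c : ⟨_⟩) → isFinite D c → 𝔹
  basisIndex c c-finite = proj₁ (proj₁ (proj₂ 𝔹≃K)) (c , c-finite)

  ι-basisIndex : (c : ⟨_⟩) (c-finite : isFinite D c) → ι (basisIndex c c-finite) ≡ c
  ι-basisIndex c c-finite = cong proj₁ (proj₂ (proj₁ (proj₂ 𝔹≃K)) (c , c-finite))

  approx : (x : ⟨_⟩) → Σ 𝔹 (λ b → ι b ⊑ x) → ⟨_⟩
  approx x = ι ∘ proj₁

  module _ (x : ⟨_⟩) where
    private
      toBasis : K↓ D x → Σ 𝔹 (λ b → ι b ⊑ x)
      toBasis (c , c-finite , c⊑x) = basisIndex c c-finite , subst (_⊑ x) (sym (ι-basisIndex c c-finite)) c⊑x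

      ⊑-toBasis : ∀ {z} (c : K↓ D x) → z ⊑ proj₁ c → z ⊑ approx x (toBasis c)
      ⊑-toBasis {z} (c , c-finite , _) = subst (z ⊑_) (sym (ι-basisIndex c c-finite))

      large-directed = proj₁ (proj₁ algebraic x)
      large-isLub = proj₂ (proj₁ algebraic x)

    approx-directed : Directed _⊑_ (approx x)
    approx-directed =
      ∥∥-map toBasis (proj₁ large-directed) ,
      λ (b , b⊑x) (c , c⊑x) →
        ∥∥-map (λ (e , b⊑e , c⊑e) → toBasis e , ⊑-toBasis e b⊑e , ⊑-toBasis e c⊑e)
               (proj₂ large-directed (ι b , ι-finite b , b⊑x) (ι c , ι-finite c , c⊑x))

    approx-sup : ⨆ (approx x) approx-directed ≡ x
    approx-sup = ⊑-antisym _ _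
      (⨆-least (approx x) approx-directed x proj₂)
      (proj₂ large-isLub _ λ c →
        ⊑-trans′ (⊑-toBasis c (⊑-refl _)) (⨆-upper (approx x) approx-directed (toBasis c)))

  interpolate : (b c : 𝔹) → ι b ⊑ x → ι c ⊑ x → ∥ Σ 𝔹 (λ e → ι b ⊑ ι e × ι c ⊑ ι e × ι e ⊑ x) ∥
  interpolate {x} b c b⊑x c⊑x =
    ∥∥-map (λ ((e , e⊑x) , b⊑e , c⊑e) → e , b⊑e , c⊑e , e⊑x) (proj₂ (approx-directed x) (b , b⊑x) (c , c⊑x))

  basis-∈ : (V : 𝕆) → x ∈ V → ∥ Σ 𝔹 (λ b → ι b ⊑ x × ι b ∈ V) ∥
  basis-∈ {x} V x∈V =
    ∥∥-map (λ ((b , b⊑x) , b∈V) → b , b⊑x , b∈V)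
           (∈-inaccessible V (approx x) (approx-directed x) (subst (_∈ V) (sym (approx-sup x)) x∈V))

  ⊥ᵇ : 𝔹
  ⊥ᵇ = basisIndex (proj₁ least) λ _ δ _ → ∥∥-map (λ i → i , proj₂ least _) (proj₁ δ)

  ⊥ᵇ-least : (x : ⟨_⟩) → ι ⊥ᵇ ⊑ x
  ⊥ᵇ-least x = subst (_⊑ x) (sym (ι-basisIndex _ _)) (proj₂ least x)

  pairLub-finite : {c d s : ⟨_⟩} → isFinite D c → isFinite D d → isLub D (pair c d) s → isFinite D s
  pairLub-finite c-finite d-finite (s-upper , s-least) α δ s⊑⨆ =
    ∥∥-bind (c-finite α δ (⊑-trans′ (s-upper (lift true)) s⊑⨆)) λ (i , c⊑αᵢ) →
    ∥∥-bind (d-finite α δ (⊑-trans′ (s-upper (lift false)) s⊑⨆)) λ (j , d⊑αⱼ) →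
    ∥∥-map (λ (k , i≤k , j≤k) → k , s-least (α k) λ { (lift true) → ⊑-trans′ c⊑αᵢ i≤k
                                                    ; (lift false) → ⊑-trans′ d⊑αⱼ j≤k })
           (proj₂ δ i j)

  basisJoin : (b c : 𝔹) → ∥ Σ ⟨_⟩ (λ z → ι b ⊑ z × ι c ⊑ z) ∥
            → Σ 𝔹 (λ e → ι b ⊑ ι e × ι c ⊑ ι e × (∀ z → ι b ⊑ z → ι c ⊑ z → ι e ⊑ z))
  basisJoin b c bounded = e , upper (lift true) , upper (lift false) , λ z b⊑z c⊑z → below z b⊑z c⊑z
    where
    lub = bounded-complete (pair (ι b) (ι c))
            (∥∥-map (λ (z , b⊑z , c⊑z) → z , λ { (lift true) → b⊑z ; (lift false) → c⊑z }) bounded)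
    s = proj₁ lub
    s-finite = pairLub-finite (ι-finite b) (ι-finite c) (proj₂ lub)
    e = basisIndex s s-finite

    upper : (t : 𝟚) → pair (ι b) (ι c) t ⊑ ι e
    upper t = subst (pair (ι b) (ι c) t ⊑_) (sym (ι-basisIndex s s-finite)) (proj₁ (proj₂ lub) t)

    below : ∀ z → ι b ⊑ z → ι c ⊑ z → ι e ⊑ z
    below z b⊑z c⊑z = subst (_⊑ z) (sym (ι-basisIndex s s-finite))
                        (proj₂ (proj₂ lub) z λ { (lift true) → b⊑z ; (lift false) → c⊑z })

  ↑ : 𝔹 → 𝕆
  ↑ b = (λ y → (ι b ⊑ y) , ⊑-prop _ _) , (λ _ _ b⊑x x⊑y → ⊑-trans′ b⊑x x⊑y) , ι-finite b

  ↑-⊆ : (V : 𝕆) (b : 𝔹) → ι b ∈ V → ↑ b ⊆ V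
  ↑-⊆ V b b∈V y = ∈-upward V b∈V

  ↑-compact : (b : 𝔹) → isCompact (Scott D) (↑ b)
  ↑-compact b U δ W e ↑b⊆W =
    ∥∥-map (λ (i , b∈Uᵢ) → i , ↑-⊆ (U i) b b∈Uᵢ) (isJoin-∈⁻ {U = U} {W} e (↑b⊆W (ι b) (⊑-refl (ι b))))

  ↑-cover : (V : 𝕆) → IsJoin (Scott D) (λ (i : Σ 𝔹 (λ b → ι b ∈ V)) → ↑ (proj₁ i)) V
  ↑-cover V = isJoin-intro {U = λ (i : Σ 𝔹 (λ b → ι b ∈ V)) → ↑ (proj₁ i)} {V}
    (λ x x∈V → ∥∥-map (λ (b , b⊑x , b∈V) → (b , b∈V) , b⊑x) (basis-∈ V x∈V))
    (λ (b , b∈V) → ↑-⊆ V b b∈V)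

  ↑∩↑-cover : (b c : 𝔹)
            → IsJoin (Scott D) (λ (i : Σ 𝔹 (λ e → ι b ⊑ ι e × ι c ⊑ ι e)) → ↑ (proj₁ i)) (↑ b ∩ ↑ c)
  ↑∩↑-cover b c = isJoin-intro {U = λ (i : Σ 𝔹 (λ e → ι b ⊑ ι e × ι c ⊑ ι e)) → ↑ (proj₁ i)} {↑ b ∩ ↑ c}
    (λ x (b⊑x , c⊑x) → ∥∥-map (λ (e , b⊑e , c⊑e , e⊑x) → (e , b⊑e , c⊑e) , e⊑x) (interpolate b c b⊑x c⊑x))
    (λ (e , b⊑e , c⊑e) x e⊑x → ⊑-trans′ b⊑e e⊑x , ⊑-trans′ c⊑e e⊑x)

  ⋃ᶠ : List 𝔹 → 𝕆
  ⋃ᶠ l = ⋃ {I = Σ 𝔹 (_∈ₗ l)} (↑ ∘ proj₁)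

  ⋃ᶠ-∈ : {b : 𝔹} {l : List 𝔹} → b ∈ₗ l → ι b ⊑ x → x ∈ ⋃ᶠ l
  ⋃ᶠ-∈ b∈l b⊑x = ∣ (_ , b∈l) , b⊑x ∣

  ⋃ᶠ-⊆ : (V : 𝕆) (l : List 𝔹) → All (λ b → ι b ∈ V) l → ⋃ᶠ l ⊆ V
  ⋃ᶠ-⊆ V l l⊆V x = ∥∥-rec (∈-isProp x V) λ ((b , b∈l) , b⊑x) → ∈-upward V (All.lookup l⊆V b∈l) b⊑x

  ⋃ᶠ-++ : (l l′ : List 𝔹) → IsJoin (Scott D) (pair (⋃ᶠ l) (⋃ᶠ l′)) (⋃ᶠ (l ++ l′))
  ⋃ᶠ-++ l l′ = isJoin-intro {U = pair (⋃ᶠ l) (⋃ᶠ l′)} {⋃ᶠ (l ++ l′)}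
    (λ x → ∥∥-map λ ((b , b∈l++l′) , b⊑x) → case (∈-++⁻ l b∈l++l′) b⊑x)
    λ { (lift true) x → ∥∥-map λ ((b , b∈l) , b⊑x) → (b , ∈-++⁺ˡ b∈l) , b⊑x
      ; (lift false) x → ∥∥-map λ ((b , b∈l′) , b⊑x) → (b , ∈-++⁺ʳ l b∈l′) , b⊑x }
    where
    case : ∀ {b} → b ∈ₗ l ⊎ b ∈ₗ l′ → ι b ⊑ x → Σ 𝟚 (λ t → x ∈ pair (⋃ᶠ l) (⋃ᶠ l′) t)
    case (inj₁ b∈l) b⊑x = lift true , ⋃ᶠ-∈ b∈l b⊑x
    case (inj₂ b∈l′) b⊑x = lift false , ⋃ᶠ-∈ b∈l′ b⊑x

  ⋃ᶠ-++ˡ : (l l′ : List 𝔹) → ⋃ᶠ l ⊆ ⋃ᶠ (l ++ l′)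
  ⋃ᶠ-++ˡ l l′ = isJoin-upper {U = pair (⋃ᶠ l) (⋃ᶠ l′)} {⋃ᶠ (l ++ l′)} (⋃ᶠ-++ l l′) (lift true)

  ⋃ᶠ-++ʳ : (l l′ : List 𝔹) → ⋃ᶠ l′ ⊆ ⋃ᶠ (l ++ l′)
  ⋃ᶠ-++ʳ l l′ = isJoin-upper {U = pair (⋃ᶠ l) (⋃ᶠ l′)} {⋃ᶠ (l ++ l′)} (⋃ᶠ-++ l l′) (lift false)

  ⋃ᶠ-compact : (l : List 𝔹) → isCompact (Scott D) (⋃ᶠ l)
  ⋃ᶠ-compact l U δ W e ⋃ᶠl⊆W =
    ∥∥-map (λ (i , l⊆Uᵢ) → i , ⋃ᶠ-⊆ (U i) l l⊆Uᵢ)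
           (directed-All {Q = λ b V → ι b ∈ V} {U} δ (λ b V⊆W → V⊆W (ι b)) l
             (All.tabulate λ b∈l → isJoin-∈⁻ {U = U} {W} e (⋃ᶠl⊆W _ (⋃ᶠ-∈ b∈l (⊑-refl _)))))

  Fin⊆ : 𝕆 → Set u
  Fin⊆ V = Σ (List 𝔹) (All (λ b → ι b ∈ V))

  ⋃ᶠ-directed : (V : 𝕆) → Directed _⊆_ (λ (l : Fin⊆ V) → ⋃ᶠ (proj₁ l))
  ⋃ᶠ-directed V = ∣ [] , [] ∣ , λ (l , l⊆V) (l′ , l′⊆V) →
    ∣ (l ++ l′ , Allₚ.++⁺ l⊆V l′⊆V) ,
      ⋃ᶠ-++ˡ l l′ , ⋃ᶠ-++ʳ l l′ ∣

  ⋃ᶠ-cover : (V : 𝕆) → IsJoin (Scott D) (λ (l : Fin⊆ V) → ⋃ᶠ (proj₁ l)) V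
  ⋃ᶠ-cover V = isJoin-intro {U = λ (l : Fin⊆ V) → ⋃ᶠ (proj₁ l)} {V}
    (λ x x∈V → ∥∥-map (λ (b , b⊑x , b∈V) → ([ b ] , b∈V ∷ []) , ⋃ᶠ-∈ (here refl) b⊑x) (basis-∈ V x∈V))
    (λ (l , l⊆V) → ⋃ᶠ-⊆ V l l⊆V)

  ·-⋃ᶠ-cover : (k : Nuc) (V : 𝕆) → x ∈ k · V → ∥ Σ (Fin⊆ V) (λ l → x ∈ k · ⋃ᶠ (proj₁ l)) ∥
  ·-⋃ᶠ-cover k V = isJoin-∈⁻ {U = λ l → k · ⋃ᶠ (proj₁ l)} {k · V}
                     (·-preservesDirectedJoin k (⋃ᶠ-directed V) (⋃ᶠ-cover V))

  compact→⋃ᶠ : (U : 𝕆) → isCompact (Scott D) U → ∥ Σ (List 𝔹) (λ l → ⋃ᶠ l ⊆ U × U ⊆ ⋃ᶠ l) ∥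
  compact→⋃ᶠ U U-compact =
    ∥∥-map (λ ((l , l⊆U) , U⊆l) → l , ⋃ᶠ-⊆ U l l⊆U , U⊆l)
           (U-compact (λ (l : Fin⊆ U) → ⋃ᶠ (proj₁ l)) (⋃ᶠ-directed U) U (⋃ᶠ-cover U) λ _ → id)

  ⋃ᶠ-decidable : isSharp D x → (l : List 𝔹) → Dec (x ∈ ⋃ᶠ l)
  ⋃ᶠ-decidable x-sharp l = ∥∥-dec (anyMember? (λ b → x-sharp (ι b) (ι-finite b)) l)

  open Points (Scott D) public

  ∈ₚ-⊆ : (p : Pt (Scott D)) {A B : 𝕆} → A ⊆ B → p ∈ₚ A → p ∈ₚ B
  ∈ₚ-⊆ p {A} {B} A⊆B = ∈ₚ-mono p (⊆→isMeet {A} {B} A⊆B)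

  sharp→point : Sharp D → SpecPt (Scott D)
  sharp→point (x , x-sharp) = p , decidable→spectral p decide
    where
    p : Pt (Scott D)
    p = (λ V → proj₁ V x) ,
        (λ _ e → cong (λ F → F x) e) ,
        (λ _ _ _ e → cong (λ F → F x) e) ,
        (λ _ _ e → cong (λ F → F x) e)

    decide : (U : 𝕆) → isCompact (Scott D) U → Dec (x ∈ U)
    decide U U-compact = ∥∥-rec (Dec-isProp (∈-isProp x U))
      (λ (l , l⊆U , U⊆l) → map′ (l⊆U x) (U⊆l x) (⋃ᶠ-decidable x-sharp l)) (compact→⋃ᶠ U U-compact)

  module PointSup (p : SpecPt (Scott D)) where
    private
      p₀ = proj₁ p

    below : Σ 𝔹 (λ b → p₀ ∈ₚ ↑ b) → ⟨_⟩
    below = ι ∘ proj₁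

    below-directed : Directed _⊑_ below
    below-directed =
      ∣ ⊥ᵇ , ∈ₚ-top p₀ (isTop-intro {↑ ⊥ᵇ} ⊥ᵇ-least) ∣ ,
      λ (b , p∈↑b) (c , p∈↑c) →
        ∥∥-map (λ ((e , b⊑e , c⊑e) , p∈↑e) → (e , p∈↑e) , b⊑e , c⊑e)
               (∈ₚ-join⁻ p₀ (↑∩↑-cover b c) (∈ₚ-meet⁺ p₀ {↑ b} {↑ c} {↑ b ∩ ↑ c} refl p∈↑b p∈↑c))

    sup : ⟨_⟩
    sup = ⨆ below below-directed

    ⊑sup→∈ₚ : (b : 𝔹) → ι b ⊑ sup → p₀ ∈ₚ ↑ b
    ⊑sup→∈ₚ b b⊑sup = ∥∥-rec (∈ₚ-isProp p₀ (↑ b))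
      (λ ((c , p∈↑c) , b⊑c) → ∈ₚ-⊆ p₀ {↑ c} {↑ b} (λ _ c⊑y → ⊑-trans′ b⊑c c⊑y) p∈↑c)
      (ι-finite b below below-directed b⊑sup)

    ∈ₚ→⊑sup : (b : 𝔹) → p₀ ∈ₚ ↑ b → ι b ⊑ sup
    ∈ₚ→⊑sup b p∈↑b = ⨆-upper below below-directed (b , p∈↑b)

    sup-sharp : isSharp D sup
    sup-sharp c c-finite = subst (λ c′ → Dec (c′ ⊑ sup)) (ι-basisIndex c c-finite)
      (map′ (∈ₚ→⊑sup b) (⊑sup→∈ₚ b) (spectral→decidable p₀ (proj₂ p) (↑ b) (↑-compact b)))
      where b = basisIndex c c-finite

    sup-∈ : (V : 𝕆) → sup ∈ V → p₀ ∈ₚ V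
    sup-∈ V sup∈V = ∥∥-rec (∈ₚ-isProp p₀ V)
      (λ (b , b⊑sup , b∈V) → ∈ₚ-⊆ p₀ (↑-⊆ V b b∈V) (⊑sup→∈ₚ b b⊑sup))
      (basis-∈ V sup∈V)

    ∈ₚ-sup : (V : 𝕆) → p₀ ∈ₚ V → sup ∈ V
    ∈ₚ-sup V p∈V = ∥∥-rec (∈-isProp sup V)
      (λ ((b , b∈V) , p∈↑b) → ∈-upward V b∈V (∈ₚ→⊑sup b p∈↑b))
      (∈ₚ-join⁻ p₀ (↑-cover V) p∈V)

  point→sharp : SpecPt (Scott D) → Sharp D
  point→sharp p = sup , sup-sharp
    where open PointSup p

  Sharp≃SpecPt : Sharp D ≃ SpecPt (Scott D)
  Sharp≃SpecPt = inverses→≃ sharp→point point→sharp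
    (λ p → SpecPt-ext (PointSup.sup-∈ p) (PointSup.∈ₚ-sup p))
    (λ (x , x-sharp) → Σ-≡-prop isSharp-isProp
      (trans (cong (⨆ (approx x)) (Directed-isProp _ (approx-directed x))) (approx-sup x)))
    where
    isSharp-isProp : (x : ⟨_⟩) → isProp (isSharp D x)
    isSharp-isProp x = Π-isProp λ c → Π-isProp λ _ → Dec-isProp (⊑-prop c x)

    Directed-isProp : {α : I → ⟨_⟩} → isProp (Directed _⊑_ α)
    Directed-isProp = ×-isProp ∥∥-isProp (Π-isProp λ _ → Π-isProp λ _ → ∥∥-isProp)

module PatchBasis (fe : FunExt) (pe : PropExt) (pt : PropTrunc) (u : Level) (SD : Theory.ScottDomain pt u) where
  open ScottDomainBasis fe pe pt u SD public
  open Theory.ScottDomain {pt} {u} SD using (decidable-upper-bounds)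

  private variable
    I : Set u
    x y : ⟨_⟩

  -- ↑ d ∩ ↑ c ⊆ V, tested on basis elements only, so that it is a small proposition.
  ↑∩↑⊆ : 𝔹 → 𝔹 → 𝕆 → Set u
  ↑∩↑⊆ d c V = (e : 𝔹) → ι d ⊑ ι e → ι c ⊑ ι e → ι e ∈ V

  -- The Heyting implication ⋃ᶠ l ⇒ V: the points above some d with ↑ d ∩ ⋃ᶠ l ⊆ V.
  _⇒_ : List 𝔹 → 𝕆 → 𝕆
  l ⇒ V = (λ y → ∥ Σ 𝔹 (λ d → ι d ⊑ y × All (λ c → ↑∩↑⊆ d c V) l) ∥ , ∥∥-isProp) ,
          (λ _ _ a x⊑y → ∥∥-map (λ (d , d⊑x , d-ok) → d , ⊑-trans′ d⊑x x⊑y , d-ok) a) ,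
          (λ α δ a → ∥∥-bind a λ (d , d⊑⨆ , d-ok) →
                       ∥∥-map (λ (i , d⊑αᵢ) → i , ∣ d , d⊑αᵢ , d-ok ∣) (ι-finite d α δ d⊑⨆))

  infixr 5 _⇒_

  ⇒-mp : (l : List 𝔹) (V : 𝕆) → y ∈ l ⇒ V → y ∈ ⋃ᶠ l → y ∈ V
  ⇒-mp {y} l V y∈l⇒V = ∥∥-rec (∈-isProp y V) λ ((c , c∈l) , c⊑y) → ∥∥-rec (∈-isProp y V)
    (λ (d , d⊑y , d-ok) → ∥∥-rec (∈-isProp y V)
      (λ (e , d⊑e , c⊑e , e⊑y) → ∈-upward V (All.lookup d-ok c∈l e d⊑e c⊑e) e⊑y)
      (interpolate d c d⊑y c⊑y))
    y∈l⇒V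

  ⇒-intro : (l : List 𝔹) (A V : 𝕆) → A ∩ ⋃ᶠ l ⊆ V → A ⊆ l ⇒ V
  ⇒-intro l A V A∩l⊆V y y∈A = ∥∥-map
    (λ (d , d⊑y , d∈A) → d , d⊑y , All.tabulate λ c∈l e d⊑e c⊑e →
      A∩l⊆V (ι e) (∈-upward A d∈A d⊑e , ⋃ᶠ-∈ c∈l c⊑e))
    (basis-∈ A y∈A)

  ⇒-monotone : (l : List 𝔹) {V W : 𝕆} → V ⊆ W → l ⇒ V ⊆ l ⇒ W
  ⇒-monotone l V⊆W y = ∥∥-map λ (d , d⊑y , d-ok) →
    d , d⊑y , All.map (λ ok e d⊑e c⊑e → V⊆W (ι e) (ok e d⊑e c⊑e)) d-ok

  -- In a Scott domain ↑ d ∩ ↑ c is either empty or the compact open ↑ (d ⊔ c).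
  ↑∩↑⊆-directed : {U : I → 𝕆} → Directed _⊆_ U → {W : 𝕆} → IsJoin (Scott D) U W
                → (d c : 𝔹) → ↑∩↑⊆ d c W → ∥ Σ I (λ i → ↑∩↑⊆ d c (U i)) ∥
  ↑∩↑⊆-directed {U = U} δ {W} e d c d∩c⊆W
    with decidable-upper-bounds (ι d) (ι c) (ι-finite d) (ι-finite c)
  ... | no unbounded = ∥∥-map (λ i → i , λ e d⊑e c⊑e → ⊥-elim (unbounded ∣ ι e , d⊑e , c⊑e ∣)) (proj₁ δ)
  ... | yes bounded =
    ∥∥-map (λ (i , j∈Uᵢ) → i , λ e d⊑e c⊑e → ∈-upward (U i) j∈Uᵢ (j-least (ι e) d⊑e c⊑e))
           (isJoin-∈⁻ {U = U} {W} e (d∩c⊆W j d⊑j c⊑j))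
    where
    j = proj₁ (basisJoin d c bounded)
    d⊑j = proj₁ (proj₂ (basisJoin d c bounded))
    c⊑j = proj₁ (proj₂ (proj₂ (basisJoin d c bounded)))
    j-least = proj₂ (proj₂ (proj₂ (basisJoin d c bounded)))

  module _ (l : List 𝔹) where
    ⇒-preservesMeet : {A B C : 𝕆} → IsMeet (Scott D) A B C → IsMeet (Scott D) (l ⇒ A) (l ⇒ B) (l ⇒ C)
    ⇒-preservesMeet {A} {B} {C} e = isMeet-intro {l ⇒ A} {l ⇒ B} {l ⇒ C}
      (λ x c → ⇒-monotone l {C} {A} (isMeet-⊆ˡ {A} {B} {C} e) x c ,
               ⇒-monotone l {C} {B} (isMeet-⊆ʳ {A} {B} {C} e) x c)
      (λ x a b → ⇒-intro l ((l ⇒ A) ∩ (l ⇒ B)) C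
        (λ y ((y⇒A , y⇒B) , y∈l) → isMeet-∈⁺ {A = A} {B} {C} e (⇒-mp l A y⇒A y∈l) (⇒-mp l B y⇒B y∈l)) x (a , b))

    ⇒-idempotent : (V : 𝕆) → l ⇒ l ⇒ V ≡ l ⇒ V
    ⇒-idempotent V = ⊆-antisym
      (⇒-intro l (l ⇒ l ⇒ V) V λ y (y⇒⇒V , y∈l) → ⇒-mp l V (⇒-mp l (l ⇒ V) y⇒⇒V y∈l) y∈l)
      (⇒-intro l (l ⇒ V) (l ⇒ V) λ _ → proj₁)

    ⇒-preservesDirectedJoin : {U : I → 𝕆} → Directed _⊆_ U → {W : 𝕆} → IsJoin (Scott D) U W
                            → IsJoin (Scott D) (λ i → l ⇒ U i) (l ⇒ W)
    ⇒-preservesDirectedJoin {U = U} δ {W} e = isJoin-intro {U = λ i → l ⇒ U i} {l ⇒ W}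
      (λ x a → ∥∥-bind a λ (d , d⊑x , d-ok) →
        ∥∥-map (λ (i , d-okᵢ) → i , ∣ d , d⊑x , d-okᵢ ∣)
               (directed-All {Q = λ c V → ↑∩↑⊆ d c V} {U} δ (λ c V⊆W ok e d⊑e c⊑e → V⊆W (ι e) (ok e d⊑e c⊑e)) l
                 (All.map (↑∩↑⊆-directed {U = U} δ {W} e d _) d-ok)))
      (λ i → ⇒-monotone l {U i} {W} (isJoin-upper {U = U} {W} e i))

    closedₙ : Nuc
    closedₙ = (l ⇒_) ,
              (λ V → ⇒-intro l V V λ _ → proj₁) ,
              (λ A B C → ⇒-preservesMeet {A} {B} {C}) ,
              ⇒-idempotent ,
              (λ U δ W → ⇒-preservesDirectedJoin {U = U} δ {W})

    open⊓closed≤⊥ : openₙ (⋃ᶠ l) ⊓ closedₙ ≤ₙ ⊥ₙ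
    open⊓closed≤⊥ V x (x∈l∪V , x∈l⇒V) =
      ∣ [] , ∪-rec {V = ⋃ᶠ l} (∈-isProp x V) (⇒-mp l V x∈l⇒V) id x∈l∪V ∣

    open⊔closed≡⊤ : IsJoin PX (pair (openₙ (⋃ᶠ l)) closedₙ) ⊤ₙ
    open⊔closed≡⊤ V = isJoin-intro {U = λ s → composeList (Scott D) (pair (openₙ (⋃ᶠ l)) closedₙ) s V} {⊤ₒ}
      (λ x _ → ∣ lift true ∷ lift false ∷ [] ,
                 ⇒-intro l ⊤ₒ (⋃ᶠ l ∪ V) (λ y (_ , y∈l) → ∪-inl {V = ⋃ᶠ l} y∈l) x tt ∣)
      (λ _ _ _ → tt)

  open⊓closed≤ : (k : Nuc) (A : 𝕆) (l : List 𝔹) → A ⊆ k · ⋃ᶠ l → openₙ A ⊓ closedₙ l ≤ₙ k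
  open⊓closed≤ k A l A⊆kl V x (x∈A∪V , x∈l⇒V) = ∪-rec {V = A} (∈-isProp x (k · V))
    (λ x∈A → ·-monotone k (λ y (y∈l , y∈l⇒V) → ⇒-mp l V y∈l⇒V y∈l) x
               (·-∩ k (⋃ᶠ l) (l ⇒ V) (A⊆kl x x∈A) (·-inflationary k (l ⇒ V) x x∈l⇒V)))
    (·-inflationary k V x)
    x∈A∪V

  module _ (k : Nuc) where
    Basic : Set u
    Basic = Σ (List 𝔹 × List 𝔹) λ (m , l) → All (λ b → ι b ∈ k · ⋃ᶠ l) m

    basic : Basic → Nuc
    basic ((m , l) , _) = openₙ (⋃ᶠ m) ⊓ closedₙ l

    basic≤ : (i : Basic) → basic i ≤ₙ k
    basic≤ ((m , l) , m⊆kl) = open⊓closed≤ k (⋃ᶠ m) l (⋃ᶠ-⊆ (k · ⋃ᶠ l) m m⊆kl)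

    basic-cover : (V : 𝕆) → x ∈ k · V → ∥ Σ Basic (λ i → x ∈ basic i · V) ∥
    basic-cover V x∈kV = ∥∥-bind (·-⋃ᶠ-cover k V x∈kV) λ ((l , l⊆V) , x∈kl) →
      ∥∥-map (λ (c , c⊑x , c∈kl) → (([ c ] , l) , c∈kl ∷ []) ,
                ∪-inl {V = ⋃ᶠ [ c ]} (⋃ᶠ-∈ (here refl) c⊑x) ,
                ⇒-intro l ⊤ₒ V (λ y (_ , y∈l) → ⋃ᶠ-⊆ V l l⊆V y y∈l) _ tt)
             (basis-∈ (k · ⋃ᶠ l) x∈kl)

    basic-isJoin : IsJoin PX basic k
    basic-isJoin V = isJoin-intro {U = λ s → composeList (Scott D) basic s V} {k · V}
      (λ x x∈kV → ∥∥-map (λ (i , x∈iV) → [ i ] , x∈iV) (basic-cover V x∈kV))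
      (λ s → Joins.⋆-least basic k basic≤ s V)

    finiteBasicJoin : List Basic → Nuc
    finiteBasicJoin L = ⋁ₙ (λ (i : Σ Basic (_∈ₗ L)) → basic (proj₁ i))

    finiteBasicJoin≤ : (L : List Basic) → finiteBasicJoin L ≤ₙ k
    finiteBasicJoin≤ L = ⋁ₙ-least _ k (λ (i , _) → basic≤ i)

    finiteBasicJoin-directed : Directed _≤ₙ_ finiteBasicJoin
    finiteBasicJoin-directed = ∣ [] ∣ , λ L L′ →
      ∣ L ++ L′ ,
        ⋁ₙ-reindex (λ (i : Σ Basic (_∈ₗ L ++ L′)) → basic (proj₁ i)) (λ (i , i∈L) → i , ∈-++⁺ˡ i∈L) ,
        ⋁ₙ-reindex (λ (i : Σ Basic (_∈ₗ L ++ L′)) → basic (proj₁ i)) (λ (i , i∈L′) → i , ∈-++⁺ʳ L i∈L′) ∣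

    finiteBasicJoin-isJoin : IsJoin PX finiteBasicJoin k
    finiteBasicJoin-isJoin V = isJoin-intro {U = λ S → composeList (Scott D) finiteBasicJoin S V} {k · V}
      (λ x x∈kV → ∥∥-map (λ (i , x∈iV) → [ [ i ] ] , ∣ [ i , here refl ] , x∈iV ∣) (basic-cover V x∈kV))
      (λ S → Joins.⋆-least finiteBasicJoin k finiteBasicJoin≤ S V)

module PatchPoints (fe : FunExt) (pe : PropExt) (pt : PropTrunc) (u : Level) (SD : Theory.ScottDomain pt u) where
  open PatchBasis fe pe pt u SD public
  open Points PX using () renaming
    ( _∈ₚ_ to _∈ₕ_ ; ∈ₚ-isProp to ∈ₕ-isProp ; ∈ₚ-top to ∈ₕ-top ; ∈ₚ-meet⁻ to ∈ₕ-meet⁻ ; ∈ₚ-meet⁺ to ∈ₕ-meet⁺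
    ; ∈ₚ-join⁻ to ∈ₕ-join⁻ ; ∈ₚ-mono to ∈ₕ-mono ; ∉ₚ-emptyJoin to ∉ₕ-emptyJoin
    ; decidable→spectral to decidable→spectralₕ ; SpecPt-ext to SpecPtₕ-ext ; SpecPt≃Pt to SpecPtₕ≃Ptₕ
    ; Pt-precompose to Ptₕ-precompose )

  private variable
    I : Set u

  -- A spectral point p of Scott D extends to the patch: a nucleus contains p when it moves
  -- some compact open not containing p to one that does.
  module Extension (p : SpecPt (Scott D)) where
    private
      p₀ = proj₁ p

    ⋃ᶠ? : (l : List 𝔹) → Dec (p₀ ∈ₚ ⋃ᶠ l)
    ⋃ᶠ? l = spectral→decidable p₀ (proj₂ p) (⋃ᶠ l) (⋃ᶠ-compact l)

    ∉⋃ᶠ[] : ¬ p₀ ∈ₚ ⋃ᶠ []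
    ∉⋃ᶠ[] = ∉ₚ-emptyJoin p₀ {U = ↑ ∘ proj₁} {⋃ᶠ []} (λ { (_ , ()) }) refl

    ∉⋃ᶠ-++ : (l l′ : List 𝔹) → ¬ p₀ ∈ₚ ⋃ᶠ l → ¬ p₀ ∈ₚ ⋃ᶠ l′ → ¬ p₀ ∈ₚ ⋃ᶠ (l ++ l′)
    ∉⋃ᶠ-++ l l′ p∉l p∉l′ p∈l++l′ = ∥∥-rec (λ ())
      (λ { (lift true , p∈l) → p∉l p∈l ; (lift false , p∈l′) → p∉l′ p∈l′ })
      (∈ₚ-join⁻ p₀ {U = pair (⋃ᶠ l) (⋃ᶠ l′)} {⋃ᶠ (l ++ l′)} (⋃ᶠ-++ l l′) p∈l++l′)

    Moves : Nuc → Set u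
    Moves k = ∥ Σ (List 𝔹) (λ l → p₀ ∈ₚ k · ⋃ᶠ l × ¬ p₀ ∈ₚ ⋃ᶠ l) ∥

    composite-moves : (ks : I → Nuc) (s : List I) (V : 𝕆) → p₀ ∈ₚ composeList (Scott D) ks s V
                    → ∥ p₀ ∈ₚ V ⊎ Σ I (Moves ∘ ks) ∥
    composite-moves ks [] V p∈V = ∣ inj₁ p∈V ∣
    composite-moves ks (i ∷ s) V p∈sV = ∥∥-bind (composite-moves ks s (ks i · V) p∈sV) λ
      { (inj₂ moves) → ∣ inj₂ moves ∣
      ; (inj₁ p∈kV) → ∥∥-map (λ ((l , l⊆V) , p∈kl) → decide l l⊆V p∈kl (⋃ᶠ? l))
          (∈ₚ-join⁻ p₀ (·-preservesDirectedJoin (ks i) (⋃ᶠ-directed V) (⋃ᶠ-cover V)) p∈kV) }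
      where
      decide : (l : List 𝔹) → All (λ b → ι b ∈ V) l → p₀ ∈ₚ ks i · ⋃ᶠ l → Dec (p₀ ∈ₚ ⋃ᶠ l)
             → p₀ ∈ₚ V ⊎ Σ _ (Moves ∘ ks)
      decide l l⊆V _ (yes p∈l) = inj₁ (∈ₚ-⊆ p₀ (⋃ᶠ-⊆ V l l⊆V) p∈l)
      decide l _ p∈kl (no p∉l) = inj₂ (i , ∣ l , p∈kl , p∉l ∣)

    Moves-top : (t : Nuc) → IsTop PX t → Moves t
    Moves-top t t-top = ∣ [] , ∈ₚ-top p₀ (t-top (⋃ᶠ [])) , ∉⋃ᶠ[] ∣

    Moves-meet⁺ : {a b m : Nuc} → IsMeet PX a b m → Moves a → Moves b → Moves m
    Moves-meet⁺ {a} {b} {m} e ma mb = ∥∥-bind ma λ (l , p∈al , p∉l) → ∥∥-map (λ (l′ , p∈bl′ , p∉l′) →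
      l ++ l′ ,
      ∈ₚ-meet⁺ p₀ {a · ⋃ᶠ (l ++ l′)} {b · ⋃ᶠ (l ++ l′)} {m · ⋃ᶠ (l ++ l′)} (e (⋃ᶠ (l ++ l′)))
        (∈ₚ-⊆ p₀ (·-monotone a (⋃ᶠ-++ˡ l l′)) p∈al) (∈ₚ-⊆ p₀ (·-monotone b (⋃ᶠ-++ʳ l l′)) p∈bl′) ,
      ∉⋃ᶠ-++ l l′ p∉l p∉l′) mb

    Moves-meet⁻ : {a b m : Nuc} → IsMeet PX a b m → Moves m → Moves a × Moves b
    Moves-meet⁻ e = ∥∥-rec (×-isProp ∥∥-isProp ∥∥-isProp) λ (l , p∈ml , p∉l) →
      let p∈al , p∈bl = ∈ₚ-meet⁻ p₀ (e (⋃ᶠ l)) p∈ml in ∣ l , p∈al , p∉l ∣ , ∣ l , p∈bl , p∉l ∣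

    Moves-join⁻ : {ks : I → Nuc} {m : Nuc} → IsJoin PX ks m → Moves m → ∥ Σ I (Moves ∘ ks) ∥
    Moves-join⁻ {ks = ks} e moves = ∥∥-bind moves λ (l , p∈ml , p∉l) →
      ∥∥-bind (∈ₚ-join⁻ p₀ (e (⋃ᶠ l)) p∈ml) λ (s , p∈sl) →
      ∥∥-rec ∥∥-isProp (λ { (inj₁ p∈l) → ⊥-elim (p∉l p∈l) ; (inj₂ moves) → ∣ moves ∣ })
             (composite-moves ks s (⋃ᶠ l) p∈sl)

    Moves-join⁺ : {ks : I → Nuc} {m : Nuc} → IsJoin PX ks m → (i : I) → Moves (ks i) → Moves m
    Moves-join⁺ {ks = ks} {m} e i = ∥∥-map λ (l , p∈kl , p∉l) →
      l , ∈ₚ-join⁺ p₀ {U = λ s → composeList (Scott D) ks s (⋃ᶠ l)} {m · ⋃ᶠ l} (e (⋃ᶠ l)) [ i ] p∈kl , p∉l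

    extend : Pt PX
    extend = (λ k → Moves k , ∥∥-isProp) ,
             (λ t t-top → Ω-ext _ (λ _ → Moves-top t t-top)) ,
             (λ a b m e → Ω-ext (Moves-meet⁻ {a} {b} {m} e) (λ (ma , mb) → Moves-meet⁺ {a} {b} {m} e ma mb)) ,
             (λ ks m e → Ω-ext (Moves-join⁻ {ks = ks} {m} e)
                               (∥∥-rec ∥∥-isProp λ (i , moves) → Moves-join⁺ {ks = ks} {m} e i moves))

    Moves-open→∈ : (V : 𝕆) → Moves (openₙ V) → p₀ ∈ₚ V
    Moves-open→∈ V = ∥∥-rec (∈ₚ-isProp p₀ V) λ (l , p∈V∪l , p∉l) → ∥∥-rec (∈ₚ-isProp p₀ V)
      (λ { (lift true , p∈V) → p∈V ; (lift false , p∈l) → ⊥-elim (p∉l p∈l) })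
      (∈ₚ-join⁻ p₀ {U = pair V (⋃ᶠ l)} refl p∈V∪l)

    ∈→Moves-open : (V : 𝕆) → p₀ ∈ₚ V → Moves (openₙ V)
    ∈→Moves-open V p∈V = ∣ [] , ∈ₚ-⊆ p₀ (λ _ → ∪-inl {V = V}) p∈V , ∉⋃ᶠ[] ∣

  module PatchPoint (h : Pt PX) where
    ∈ₕ-monotone : {k j : Nuc} → k ≤ₙ j → h ∈ₕ k → h ∈ₕ j
    ∈ₕ-monotone {k} {j} k≤j = ∈ₕ-mono h {k} {j} (≤ₙ→isMeet {k} {j} k≤j)

    ∉⊥ₙ : ¬ h ∈ₕ ⊥ₙ
    ∉⊥ₙ = ∉ₕ-emptyJoin h {U = λ ()} {⊥ₙ} (λ ()) (⋁ₙ-isJoin (λ ()))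

    ∈ₕ-⊓⁺ : (k j : Nuc) → h ∈ₕ k → h ∈ₕ j → h ∈ₕ k ⊓ j
    ∈ₕ-⊓⁺ k j = ∈ₕ-meet⁺ h {k} {j} {k ⊓ j} (⊓-isMeet k j)

    ∈ₕ-⊓⁻ : (k j : Nuc) → h ∈ₕ k ⊓ j → h ∈ₕ k × h ∈ₕ j
    ∈ₕ-⊓⁻ k j = ∈ₕ-meet⁻ h {k} {j} {k ⊓ j} (⊓-isMeet k j)

    module _ (l : List 𝔹) where
      open-or-closed : ∥ h ∈ₕ openₙ (⋃ᶠ l) ⊎ h ∈ₕ closedₙ l ∥
      open-or-closed =
        ∥∥-map (λ { (lift true , o) → inj₁ o ; (lift false , c) → inj₂ c })
               (∈ₕ-join⁻ h {U = pair (openₙ (⋃ᶠ l)) (closedₙ l)} {⊤ₙ} (open⊔closed≡⊤ l) (∈ₕ-top h {⊤ₙ} ⊤ₙ-isTop))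

      ¬open×closed : ¬ (h ∈ₕ openₙ (⋃ᶠ l) × h ∈ₕ closedₙ l)
      ¬open×closed (o , c) =
        ∉⊥ₙ (∈ₕ-monotone {openₙ (⋃ᶠ l) ⊓ closedₙ l} {⊥ₙ} (open⊓closed≤⊥ l) (∈ₕ-⊓⁺ (openₙ (⋃ᶠ l)) (closedₙ l) o c))

      open? : Dec (h ∈ₕ openₙ (⋃ᶠ l))
      open? = ∥∥-rec (Dec-isProp (∈ₕ-isProp h (openₙ (⋃ᶠ l))))
        (λ { (inj₁ o) → yes o ; (inj₂ c) → no λ o → ¬open×closed (o , c) }) open-or-closed

      ¬open→closed : ¬ h ∈ₕ openₙ (⋃ᶠ l) → h ∈ₕ closedₙ l
      ¬open→closed ¬o = ∥∥-rec (∈ₕ-isProp h (closedₙ l))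
        (λ { (inj₁ o) → ⊥-elim (¬o o) ; (inj₂ c) → c }) open-or-closed

    basic? : (k : Nuc) (i : Basic k) → Dec (h ∈ₕ basic k i)
    basic? k ((m , l) , _) =
      map′ (λ (o , ¬o′) → ∈ₕ-⊓⁺ (openₙ (⋃ᶠ m)) (closedₙ l) o (¬open→closed l ¬o′))
           (λ b → let o , c = ∈ₕ-⊓⁻ (openₙ (⋃ᶠ m)) (closedₙ l) b in o , λ o′ → ¬open×closed l (o′ , c))
           (open? m ×-dec ¬? (open? l))

    -- A compact nucleus is below a finite join of basic nuclei, each decided by h.
    isSpectral : isSpectralPoint PX h
    isSpectral = decidable→spectralₕ h λ k k-compact → ∥∥-rec (Dec-isProp (∈ₕ-isProp h k))
      (λ (L , k≤L) → map′
        (∥∥-rec (∈ₕ-isProp h k) λ ((i , _) , h∈i) → ∈ₕ-monotone {basic k i} {k} (basic≤ k i) h∈i)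
        (∈ₕ-join⁻ h {U = λ (i : Σ (Basic k) (_∈ₗ L)) → basic k (proj₁ i)} {finiteBasicJoin k L}
                  (⋁ₙ-isJoin _) ∘ ∈ₕ-monotone {k} {finiteBasicJoin k L} k≤L)
        (∥∥-dec (anyMember? (basic? k) L)))
      (k-compact (finiteBasicJoin k) (finiteBasicJoin-directed k) k (finiteBasicJoin-isJoin k) λ _ _ → id)

    restrict : Pt (Scott D)
    restrict = Ptₕ-precompose {Z = Scott D} openₙ openₙ-isFrameHom h

    restrict-spectral : isSpectralPoint (Scott D) restrict
    restrict-spectral = decidable→spectral restrict λ U U-compact → ∥∥-rec (Dec-isProp (∈ₚ-isProp restrict U))
      (λ (l , l⊆U , U⊆l) → map′ (∈ₕ-monotone {openₙ (⋃ᶠ l)} {openₙ U} (openₙ-monotone l⊆U))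
                                (∈ₕ-monotone {openₙ U} {openₙ (⋃ᶠ l)} (openₙ-monotone U⊆l)) (open? l))
      (compact→⋃ᶠ U U-compact)

    open Extension (restrict , restrict-spectral) using (Moves)

    Moves→∈ₕ : (k : Nuc) → Moves k → h ∈ₕ k
    Moves→∈ₕ k = ∥∥-rec (∈ₕ-isProp h k) λ (l , h∈o[kl] , h∉o[l]) →
      ∈ₕ-monotone {openₙ (k · ⋃ᶠ l) ⊓ closedₙ l} {k} (open⊓closed≤ k (k · ⋃ᶠ l) l (λ _ → id))
        (∈ₕ-⊓⁺ (openₙ (k · ⋃ᶠ l)) (closedₙ l) h∈o[kl] (¬open→closed l h∉o[l]))

    ∈ₕ→Moves : (k : Nuc) → h ∈ₕ k → Moves k
    ∈ₕ→Moves k h∈k = ∥∥-map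
      (λ (((m , l) , m⊆kl) , h∈i) →
        let h∈o[m] , h∈c[l] = ∈ₕ-⊓⁻ (openₙ (⋃ᶠ m)) (closedₙ l) h∈i
        in l , ∈ₕ-monotone {openₙ (⋃ᶠ m)} {openₙ (k · ⋃ᶠ l)} (openₙ-monotone (⋃ᶠ-⊆ (k · ⋃ᶠ l) m m⊆kl)) h∈o[m] ,
           λ h∈o[l] → ¬open×closed l (h∈o[l] , h∈c[l]))
      (∈ₕ-join⁻ h {U = basic k} {k} (basic-isJoin k) h∈k)

  SpecPt≃SpecPtPatch : SpecPt (Scott D) ≃ SpecPt PX
  SpecPt≃SpecPtPatch = inverses→≃ to from
    (λ (h , _) → SpecPtₕ-ext (PatchPoint.Moves→∈ₕ h) (PatchPoint.∈ₕ→Moves h))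
    (λ p → SpecPt-ext (Extension.Moves-open→∈ p) (Extension.∈→Moves-open p))
    where
    to : SpecPt (Scott D) → SpecPt PX
    to p = Extension.extend p , PatchPoint.isSpectral (Extension.extend p)

    from : SpecPt PX → SpecPt (Scott D)
    from (h , _) = PatchPoint.restrict h , PatchPoint.restrict-spectral h

  SpecPtPatch≃PtPatch : SpecPt PX ≃ Pt PX
  SpecPtPatch≃PtPatch = SpecPtₕ≃Ptₕ PatchPoint.isSpectral

mainTheorem17 : FunExt → PropExt → (pt : PropTrunc) → (u : Level) → (D : Theory.ScottDomain pt u)
    → let open Theory pt u in
      let D₀ = ScottDomain.dcpo D in
      (Sharp D₀ ≃ SpecPt (Scott D₀))
      × (SpecPt (Scott D₀) ≃ SpecPt (Patch (Scott D₀)))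
      × (SpecPt (Patch (Scott D₀)) ≃ Pt (Patch (Scott D₀)))
mainTheorem17 fe pe pt u D = Sharp≃SpecPt , SpecPt≃SpecPtPatch , SpecPtPatch≃PtPatch
  where open PatchPoints fe pe pt u D
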